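{- Let $G$ be a graph (possibly with loops) with vertex set $V$, identified with its symmetric adjacency matrix over $GF(2)$, and let $p_1(G)(y) = \sum_{X \subseteq V} (-1)^{|X|} y^{d_{\mathcal{M}_G * X}}$. Then $$ p_1(G)(y) = \sum_{X \subseteq V} (-1)^{|X|} y^{\nu(G[X])}. $$ Moreover, $p_1(G)(y)$ satisfies the following characterizing recursive relation. If $u$ is a looped vertex, then $p_1(G)(y) = p_1(G\setminus u)(y) - p_1(G*u\setminus u)(y)$. If $\{u,v\}$ is an edge where both $u$ and $v$ are not looped, then $p_1(G)(y) = p_1(G\setminus u)(y) + p_1(G*\{u,v\}\setminus u)(y)$. If $u$ is an isolated vertex (no edge is adjacent to $u$) of $G$, then $p_1(G)(y) = (1-y)\, p_1(G\setminus u)(y)$. Finally, if $G$ is the empty graph, then $p_1(G)(y) = 1$.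
   Context: $\mathcal{M}_G$ is the set system $(V,D)$ where $X \in D$ iff the principal submatrix $G[X]$ of the adjacency matrix is nonsingular over $GF(2)$ (with $G[\emptyset]$ nonsingular by convention). For a set system $M$ and $X\subseteq V$, the twist $M*X$ is $(V,\{Y \mathrm{\Delta} X \mid Y \in M\})$, and $d_M$ is the smallest cardinality of a set in $M$. $\nu(G[X])$ denotes the nullity over $GF(2)$ of the principal submatrix $G[X]$. $G\setminus u$ is the graph with vertex $u$ deleted. For $Z\subseteq V$ with $G[Z]$ nonsingular, $G*Z$ is the principal pivot transform of the adjacency matrix on $Z$ (with respect to the partition $(Z,V\setminus Z)$, $\begin{pmatrix} P & Q \\ R & S\end{pmatrix} \mapsto \begin{pmatrix} P^{ -1} & -P^{ -1}Q \\ RP^{ -1} & S - RP^{ -1}Q\end{pmatrix}$); for a looped vertex $u$, $G*u$ is local complementation at $u$ (complementing adjacency, including loops, among the neighbours of $u$), and for an edge $\{u,v\}$ with $u,v$ unlooped, $G*\{u,v\}$ is edge local complementation. Operations are applied left to right. -}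

module Defs where

open import Data.Bool using (Bool; true; false; _∧_; _∨_; not; _xor_; if_then_else_)
open import Data.Nat as ℕ using (ℕ; zero; suc; _⊓_; _≡ᵇ_)
open import Data.Nat.Logarithm using (⌊log₂_⌋)
open import Data.Fin using (Fin; zero; suc; punchIn; _≟_)
open import Data.Fin.Subset using (Subset; ∣_∣)
open import Data.Vec using (Vec; []; _∷_; lookup; zipWith)
open import Data.List using (List; []; _∷_; [_]; map; _++_; foldr; length; filterᵇ)
open import Data.Integer as ℤ using (ℤ; _^_; -_)
open import Relation.Nullary.Decidable using (⌊_⌋)
open import Relation.Binary.PropositionalEquality using (_≡_)

-- A (possibly looped) graph on vertex set Fin n, identified with its
-- adjacency matrix over GF(2) (entries in Bool, xor = +, ∧ = ·).
Matrix : ℕ → Set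
Matrix n = Fin n → Fin n → Bool

Symmetric : ∀ {n} → Matrix n → Set
Symmetric G = ∀ i j → G i j ≡ G j i

allFin : ∀ n → (Fin n → Bool) → Bool
allFin zero    f = true
allFin (suc n) f = f zero ∧ allFin n (λ i → f (suc i))

sumFin : ∀ n → (Fin n → Bool) → Bool
sumFin zero    f = false
sumFin (suc n) f = f zero xor sumFin n (λ i → f (suc i))

allSubsets : ∀ n → List (Subset n)
allSubsets zero    = [ [] ]
allSubsets (suc n) = map (true ∷_) (allSubsets n) ++ map (false ∷_) (allSubsets n)

_Δ_ : ∀ {n} → Subset n → Subset n → Subset n
_Δ_ = zipWith _xor_

-- x is a kernel vector of the principal submatrix G[X]
-- (vectors of GF(2)^X are vectors of GF(2)^n supported in X)
inKernel : ∀ {n} → Matrix n → Subset n → Subset n → Bool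
inKernel {n} G X x =
  allFin n (λ j → not (lookup x j) ∨ lookup X j) ∧
  allFin n (λ i → not (lookup X i) ∨ not (sumFin n (λ j → G i j ∧ lookup x j)))

kernelSize : ∀ {n} → Matrix n → Subset n → ℕ
kernelSize {n} G X = length (filterᵇ (inKernel G X) (allSubsets n))

-- nullity ν(G[X]) = dim ker G[X] = log₂ |ker G[X]|
nullity : ∀ {n} → Matrix n → Subset n → ℕ
nullity G X = ⌊log₂ kernelSize G X ⌋

-- G[X] nonsingular over GF(2) (trivial kernel; G[∅] is nonsingular)
nonsingular : ∀ {n} → Matrix n → Subset n → Bool
nonsingular G X = kernelSize G X ≡ᵇ 1

SetSystem : ℕ → Set
SetSystem n = List (Subset n)

MG : ∀ {n} → Matrix n → SetSystem n
MG {n} G = filterᵇ (nonsingular G) (allSubsets n)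

twist : ∀ {n} → SetSystem n → Subset n → SetSystem n
twist M X = map (λ Y → Y Δ X) M

-- d_M : smallest cardinality of a set in M (for nonempty M;
-- n is an upper bound of all cardinalities so it is a neutral start)
dmin : ∀ {n} → SetSystem n → ℕ
dmin {n} M = foldr _⊓_ n (map ∣_∣ M)

sumSubsets : ∀ n → (Subset n → ℤ) → ℤ
sumSubsets n f = foldr ℤ._+_ (ℤ.+ 0) (map f (allSubsets n))

sign : ℕ → ℤ
sign k = (- ℤ.+ 1) ^ k

p₁ : ∀ {n} → Matrix n → ℤ → ℤ
p₁ {n} G y = sumSubsets n (λ X → sign ∣ X ∣ ℤ.* (y ^ dmin (twist (MG G) X)))

nullityPoly : ∀ {n} → Matrix n → ℤ → ℤ
nullityPoly {n} G y = sumSubsets n (λ X → sign ∣ X ∣ ℤ.* (y ^ nullity G X))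

del : ∀ {n} → Matrix (suc n) → Fin (suc n) → Matrix n
del G u i j = G (punchIn u i) (punchIn u j)

_==_ : ∀ {n} → Fin n → Fin n → Bool
i == j = ⌊ i ≟ j ⌋

-- G * u for a looped vertex u: principal pivot transform on {u}, i.e.
-- local complementation: for v, w ≠ u the entry (v,w) is flipped iff
-- v and w are both neighbours of u (loops included); row/column u unchanged.
localComp : ∀ {n} → Matrix n → Fin n → Matrix n
localComp G u v w =
  if (v == u) ∨ (w == u) then G v w else (G v w xor (G u v ∧ G u w))

-- G * {u,v} for an edge {u,v} with u, v unlooped: principal pivot
-- transform on {u,v}.  With P = G[{u,v}] = [[0,1],[1,0]] = P⁻¹:
--   entries (x,y), x,y ∉ {u,v}:  G x y + G x u·G v y + G x v·G u y
--   row u becomes old row v, row v becomes old row u (outside {u,v}),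
--   symmetrically for columns, and the {u,v}-block stays P.
edgeComp : ∀ {n} → Matrix n → Fin n → Fin n → Matrix n
edgeComp G u v x y =
  if inUV x ∧ inUV y then G x y
  else if x == u then G v y
  else if x == v then G u y
  else if y == u then G x v
  else if y == v then G x u
  else (G x y xor ((G x u ∧ G v y) xor (G x v ∧ G u y)))
  where
  inUV : _ → Bool
  inUV z = (z == u) ∨ (z == v)

-- the recursive relation of the lemma, for a graph invariant f
-- (with values polynomials in y, represented by their evaluation at every y ∈ ℤ)
Recursion : (∀ {n} → Matrix n → ℤ → ℤ) → Set
Recursion f =
  (∀ {n} (G : Matrix (suc n)) → Symmetric G → ∀ u → G u u ≡ true →
     ∀ y → f G y ≡ f (del G u) y ℤ.- f (del (localComp G u) u) y) ×
  (∀ {n} (G : Matrix (suc n)) → Symmetric G → ∀ u v → G u v ≡ true →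
     G u u ≡ false → G v v ≡ false →
     ∀ y → f G y ≡ f (del G u) y ℤ.+ f (del (edgeComp G u v) u) y) ×
  (∀ {n} (G : Matrix (suc n)) → Symmetric G → ∀ u → (∀ w → G u w ≡ false) →
     ∀ y → f G y ≡ (ℤ.+ 1 ℤ.- y) ℤ.* f (del G u) y) ×
  (∀ (G : Matrix 0) → ∀ y → f G y ≡ ℤ.+ 1)
  where open import Data.Product using (_×_)

-- M_G * X consists of the sets Y Δ X with G[Y] nonsingular, so d_{M_G * X} is the Hamming
-- distance from X to the nearest nonsingular Y. Toggling one vertex at most doubles or halves
-- ker G[X], so it changes the nullity ν(G[X]) = log₂ |ker G[X]| by at most one, and the distance
-- is at least ν(G[X]); for symmetric G, deleting from X a vertex in the support of a kernel
-- vector halves the kernel, so the bound is attained. Each rule of the recursion comes from a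
-- bijection between ker G[X ∪ u] and the kernel of a principal submatrix of G ∖ u, G * u ∖ u or
-- G * {u,v} ∖ u (the last one on X Δ {v}); since a nonempty graph has a looped vertex, an edge
-- or an isolated vertex, the rules determine p₁ by induction on the number of vertices.

module Submission where

open import Defs
open import Algebra.Bundles using (CommutativeMonoid; CommutativeRing)
open import Data.Bool as Bool using (Bool; true; false; _∧_; _∨_; not; _xor_)
open import Data.Bool.Properties
  using ( xor-comm; xor-assoc; xor-same; xor-identityʳ; ∧-comm; ∧-assoc; ∧-zeroʳ; ∧-identityʳ
        ; ∧-distribˡ-xor; ∧-distribʳ-xor; not-¬; ¬-not; T-≡; xor-∧-commutativeRing )
open import Data.Bool.Solver using (module xor-∧-Solver)
open import Algebra.Properties.Semiring.Sum (CommutativeRing.semiring xor-∧-commutativeRing)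
  using (sum; sum-cong-≗; ∑-distrib-+; ∑-comm; sum-remove; *-distribˡ-sum)
open import Data.Empty using (⊥-elim)
open import Data.Fin using (Fin; zero; suc; punchIn; punchOut; _≟_)
open import Data.Fin.Properties using (punchInᵢ≢i; punchIn-injective; punchIn-punchOut; any?)
open import Data.Fin.Subset using (Subset; ∣_∣; ⁅_⁆) renaming (⊥ to ∅)
open import Data.Fin.Subset.Properties using (∣p∣≤n; anySubset?)
open import Data.Integer as ℤ using (ℤ; -_; _-_; _^_)
import Data.Integer.Properties as ℤ
open import Data.Integer.Tactic.RingSolver using (solve-∀)
open import Data.List using ([]; _∷_; _++_; map; foldr; filterᵇ; length)
open import Data.List.Properties using (map-++; map-∘; map-cong; foldr-++)
open import Data.List.Membership.Propositional using (_∈_)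
open import Data.List.Membership.Propositional.Properties
  using (∈-++⁺ˡ; ∈-++⁺ʳ; ∈-map⁺; ∈-map⁻; ∈-filter⁺; ∈-filter⁻)
open import Data.List.Relation.Unary.Any using (here; there)
open import Data.Nat as ℕ using (ℕ; zero; suc; _+_; _≤_; z≤n; _⊓_)
import Data.Nat.Properties as ℕ
open import Algebra.Properties.CommutativeSemigroup ℕ.+-commutativeSemigroup using (x∙yz≈y∙xz)
open import Data.Nat.Logarithm using (⌊log₂_⌋; ⌊log₂⌋-mono-≤; ⌊log₂[2*b]⌋≡1+⌊log₂b⌋)
open import Data.Product using (∃; _×_; _,_; proj₁; proj₂)
open import Data.Product.Function.NonDependent.Propositional using (_×-⇔_)
open import Data.Sum using (_⊎_; inj₁; inj₂; [_,_]′)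
open import Data.Vec using ([]; _∷_; lookup; insertAt; _[_]≔_; tabulate)
open import Data.Vec.Properties
  using ( lookup-zipWith; lookup-replicate; zipWith-identityʳ; insertAt-lookup; insertAt-punchIn
        ; lookup∘update; lookup∘update′; []≔-idempotent; []≔-lookup; ∷-injectiveˡ; ∷-injectiveʳ
        ; tabulate-cong; tabulate∘lookup )
open import Function using (_∘_; _⇔_; mk⇔; Equivalence)
open import Function.Construct.Composition using (_⇔-∘_)
open import Function.Construct.Identity using (⇔-id)
open import Function.Construct.Symmetry using (⇔-sym)
open import Relation.Binary.PropositionalEquality
  using (_≡_; _≢_; refl; sym; trans; cong; cong₂; subst; module ≡-Reasoning)
open import Relation.Nullary using (Dec; yes; no)
import Relation.Nullary.Decidable as Dec
open import Relation.Nullary.Decidable using (_×-dec_; isYes≗does; dec-true; dec-false)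

bit : Bool → ℕ
bit false = 0
bit true  = 1

≡-by-truth : ∀ {b c} → (b ≡ true → c ≡ true) → (c ≡ true → b ≡ true) → b ≡ c
≡-by-truth {false} {false} _ _ = refl
≡-by-truth {false} {true}  _ g = g refl
≡-by-truth {true}  {false} f _ = sym (f refl)
≡-by-truth {true}  {true}  _ _ = refl

∧-≡-true : ∀ {a b} → a ∧ b ≡ true → a ≡ true × b ≡ true
∧-≡-true {true} {true} _ = refl , refl

true≢false : true ≢ false
true≢false ()

not-≡-true : ∀ {a} → not a ≡ true → a ≡ false
not-≡-true {false} _ = refl

xor-≡-false : ∀ {a b} → a xor b ≡ false → a ≡ b
xor-≡-false {false} {false} _ = refl
xor-≡-false {true}  {true}  _ = refl

==-refl : ∀ {n} (i : Fin n) → (i == i) ≡ true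
==-refl i = trans (isYes≗does (i ≟ i)) (dec-true (i ≟ i) refl)

==-≢ : ∀ {n} {i j : Fin n} → i ≢ j → (i == j) ≡ false
==-≢ {i = i} {j} i≢j = trans (isYes≗does (i ≟ j)) (dec-false (i ≟ j) i≢j)

sumFin≡sum : ∀ n (f : Fin n → Bool) → sumFin n f ≡ sum f
sumFin≡sum zero    f = refl
sumFin≡sum (suc n) f = cong (f zero xor_) (sumFin≡sum n (f ∘ suc))

module _ {n : ℕ} where

  sumFin-cong : {f g : Fin n → Bool} → (∀ i → f i ≡ g i) → sumFin n f ≡ sumFin n g
  sumFin-cong {f} {g} f≗g = begin
    sumFin n f ≡⟨ sumFin≡sum n f ⟩
    sum f      ≡⟨ sum-cong-≗ f≗g ⟩
    sum g      ≡⟨ sumFin≡sum n g ⟨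
    sumFin n g ∎
    where open ≡-Reasoning

  sumFin-xor : (f g : Fin n → Bool) → sumFin n (λ i → f i xor g i) ≡ sumFin n f xor sumFin n g
  sumFin-xor f g = begin
    sumFin n (λ i → f i xor g i) ≡⟨ sumFin≡sum n _ ⟩
    sum (λ i → f i xor g i)      ≡⟨ ∑-distrib-+ f g ⟩
    sum f xor sum g              ≡⟨ cong₂ _xor_ (sumFin≡sum n f) (sumFin≡sum n g) ⟨
    sumFin n f xor sumFin n g    ∎
    where open ≡-Reasoning

  sumFin-∧ˡ : ∀ c (f : Fin n → Bool) → sumFin n (λ i → c ∧ f i) ≡ c ∧ sumFin n f
  sumFin-∧ˡ c f = begin
    sumFin n (λ i → c ∧ f i) ≡⟨ sumFin≡sum n _ ⟩
    sum (λ i → c ∧ f i)      ≡⟨ *-distribˡ-sum c f ⟨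
    c ∧ sum f                ≡⟨ cong (c ∧_) (sumFin≡sum n f) ⟨
    c ∧ sumFin n f           ∎
    where open ≡-Reasoning

  sumFin-zero : (f : Fin n → Bool) → (∀ i → f i ≡ false) → sumFin n f ≡ false
  sumFin-zero f f≗0 = trans (sumFin-cong {g = λ _ → false} f≗0) (sumFin-∧ˡ false f)

  sumFin-comm : ∀ {m} (f : Fin n → Fin m → Bool) →
                sumFin n (λ i → sumFin m (f i)) ≡ sumFin m (λ j → sumFin n (λ i → f i j))
  sumFin-comm {m} f = begin
    sumFin n (λ i → sumFin m (f i))          ≡⟨ sumFin≡sum n _ ⟩
    sum (λ i → sumFin m (f i))               ≡⟨ sum-cong-≗ (λ i → sumFin≡sum m (f i)) ⟩
    sum (λ i → sum (f i))                    ≡⟨ ∑-comm f ⟩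
    sum (λ j → sum (λ i → f i j))            ≡⟨ sum-cong-≗ (λ j → sumFin≡sum n (λ i → f i j)) ⟨
    sum (λ j → sumFin n (λ i → f i j))       ≡⟨ sumFin≡sum m _ ⟨
    sumFin m (λ j → sumFin n (λ i → f i j))  ∎
    where open ≡-Reasoning

sumFin-punchIn : ∀ {n} (u : Fin (suc n)) (f : Fin (suc n) → Bool) →
                 sumFin (suc n) f ≡ f u xor sumFin n (f ∘ punchIn u)
sumFin-punchIn {n} u f = begin
  sumFin (suc n) f                  ≡⟨ sumFin≡sum (suc n) f ⟩
  sum f                             ≡⟨ sum-remove {i = u} f ⟩
  f u xor sum (f ∘ punchIn u)       ≡⟨ cong (f u xor_) (sumFin≡sum n _) ⟨
  f u xor sumFin n (f ∘ punchIn u)  ∎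
  where open ≡-Reasoning

_⊑_ : ∀ {n} → Subset n → Subset n → Set
x ⊑ X = ∀ j → lookup x j ≡ true → lookup X j ≡ true

lookup-[]≔⁺ : ∀ {n} (X : Subset n) {w i} b → i ≢ w → lookup X i ≡ true → lookup (X [ w ]≔ b) i ≡ true
lookup-[]≔⁺ X b i≢w = trans (lookup∘update′ i≢w X b)

lookup-[]≔⁻ : ∀ {n} (X : Subset n) {w i} b → i ≢ w → lookup (X [ w ]≔ b) i ≡ true → lookup X i ≡ true
lookup-[]≔⁻ X b i≢w = trans (sym (lookup∘update′ i≢w X b))

[]≔-⊑ : ∀ {n} (X Y : Subset n) w {b b'} → (b ≡ true → b' ≡ true) → X ⊑ Y →
        (X [ w ]≔ b) ⊑ (Y [ w ]≔ b')
[]≔-⊑ X Y w {b} {b'} b⇒b' X⊑Y j with j ≟ w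
... | yes refl = λ h → trans (lookup∘update j Y b') (b⇒b' (trans (sym (lookup∘update j X b)) h))
... | no  j≢w  = lookup-[]≔⁺ Y b' j≢w ∘ X⊑Y j ∘ lookup-[]≔⁻ X b j≢w

⊑-refl : ∀ {n} {X : Subset n} → X ⊑ X
⊑-refl _ h = h

⊑-drop : ∀ {n} {x X : Subset n} w → x ⊑ X → lookup x w ≡ false → x ⊑ (X [ w ]≔ false)
⊑-drop {X = X} w x⊑X xw≡false j xj with j ≟ w
... | yes refl = ⊥-elim (true≢false (trans (sym xj) xw≡false))
... | no  j≢w  = lookup-[]≔⁺ X false j≢w (x⊑X j xj)

[]≔false-⊑[]≔ : ∀ {n} (X : Subset n) w b → (X [ w ]≔ false) ⊑ (X [ w ]≔ b)
[]≔false-⊑[]≔ X w b = []≔-⊑ X X w (λ ()) (⊑-refl {X = X})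

[]≔false-⊑ : ∀ {n} (X : Subset n) w → (X [ w ]≔ false) ⊑ X
[]≔false-⊑ X w j h = subst (λ Y → lookup Y j ≡ true) ([]≔-lookup X w) ([]≔false-⊑[]≔ X w (lookup X w) j h)

⊑-[]≔⁻ : ∀ {n} (x X : Subset n) w {s b} → (x [ w ]≔ s) ⊑ (X [ w ]≔ b) →
         (lookup x w ≡ true → lookup X w ≡ true) → x ⊑ X
⊑-[]≔⁻ x X w {s} {b} x⊑X xw⇒Xw j with j ≟ w
... | yes refl = xw⇒Xw
... | no  j≢w  = lookup-[]≔⁻ X b j≢w ∘ x⊑X j ∘ lookup-[]≔⁺ x s j≢w

Subset-ext : ∀ {n} {x y : Subset n} → (∀ i → lookup x i ≡ lookup y i) → x ≡ y
Subset-ext {x = x} {y} x≗y = begin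
  x                    ≡⟨ tabulate∘lookup x ⟨
  tabulate (lookup x)  ≡⟨ tabulate-cong x≗y ⟩
  tabulate (lookup y)  ≡⟨ tabulate∘lookup y ⟩
  y                    ∎
  where open ≡-Reasoning

lookup-Δ : ∀ {n} (x y : Subset n) i → lookup (x Δ y) i ≡ lookup x i xor lookup y i
lookup-Δ x y i = lookup-zipWith _xor_ i x y

Δ-comm : ∀ {n} (x y : Subset n) → x Δ y ≡ y Δ x
Δ-comm x y = Subset-ext λ i →
  trans (lookup-Δ x y i) (trans (xor-comm (lookup x i) (lookup y i)) (sym (lookup-Δ y x i)))

Δ-cancelʳ : ∀ {n} (x c : Subset n) → (x Δ c) Δ c ≡ x
Δ-cancelʳ x c = Subset-ext λ i → begin
  lookup ((x Δ c) Δ c) i                      ≡⟨ lookup-Δ (x Δ c) c i ⟩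
  lookup (x Δ c) i xor lookup c i             ≡⟨ cong (_xor lookup c i) (lookup-Δ x c i) ⟩
  (lookup x i xor lookup c i) xor lookup c i  ≡⟨ xor-assoc (lookup x i) _ _ ⟩
  lookup x i xor (lookup c i xor lookup c i)  ≡⟨ cong (lookup x i xor_) (xor-same (lookup c i)) ⟩
  lookup x i xor false                        ≡⟨ xor-identityʳ (lookup x i) ⟩
  lookup x i                                  ∎
  where open ≡-Reasoning

Δ-self : ∀ {n} (x : Subset n) → ∣ x Δ x ∣ ≡ 0
Δ-self []          = refl
Δ-self (true ∷ x)  = Δ-self x
Δ-self (false ∷ x) = Δ-self x

Δ-⁅⁆ : ∀ {n} (X : Subset n) w → X Δ ⁅ w ⁆ ≡ X [ w ]≔ not (lookup X w)
Δ-⁅⁆ (a ∷ X) zero    = cong₂ _∷_ (xor-comm a true) (zipWith-identityʳ xor-identityʳ X)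
Δ-⁅⁆ (a ∷ X) (suc w) = cong₂ _∷_ (xor-identityʳ a) (Δ-⁅⁆ X w)

Δ-[]≔ : ∀ {n} (Y X : Subset n) w b → Y Δ (X [ w ]≔ b) ≡ (Y Δ X) [ w ]≔ (lookup Y w xor b)
Δ-[]≔ (y ∷ Y) (x ∷ X) zero    b = refl
Δ-[]≔ (y ∷ Y) (x ∷ X) (suc w) b = cong ((y xor x) ∷_) (Δ-[]≔ Y X w b)

∣∷∣ : ∀ {n} b (x : Subset n) → ∣ b ∷ x ∣ ≡ bit b + ∣ x ∣
∣∷∣ true  x = refl
∣∷∣ false x = refl

∣[]≔false∣ : ∀ {n} (x : Subset n) w → ∣ x ∣ ≡ bit (lookup x w) + ∣ x [ w ]≔ false ∣
∣[]≔false∣ (a ∷ x) zero    = ∣∷∣ a x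
∣[]≔false∣ (a ∷ x) (suc w) = begin
  ∣ a ∷ x ∣                                   ≡⟨ ∣∷∣ a x ⟩
  bit a + ∣ x ∣                               ≡⟨ cong (bit a +_) (∣[]≔false∣ x w) ⟩
  bit a + (bit (lookup x w) + ∣ x₀ ∣)         ≡⟨ x∙yz≈y∙xz (bit a) (bit (lookup x w)) ∣ x₀ ∣ ⟩
  bit (lookup x w) + (bit a + ∣ x₀ ∣)         ≡⟨ cong (bit (lookup x w) +_) (∣∷∣ a x₀) ⟨
  bit (lookup x w) + ∣ a ∷ x₀ ∣               ∎
  where
  open ≡-Reasoning
  x₀ = x [ w ]≔ false

∣Δ[]≔false∣ : ∀ {n} (Y X : Subset n) w → lookup Y w ≡ false → lookup X w ≡ true →
                ∣ Y Δ X ∣ ≡ suc ∣ Y Δ (X [ w ]≔ false) ∣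
∣Δ[]≔false∣ Y X w Yw Xw = begin
  ∣ Y Δ X ∣                                          ≡⟨ ∣[]≔false∣ (Y Δ X) w ⟩
  bit (lookup (Y Δ X) w) + ∣ (Y Δ X) [ w ]≔ false ∣  ≡⟨ cong₂ (λ a b → bit a + ∣ (Y Δ X) [ w ]≔ b ∣) YΔX-w Y-w ⟩
  suc ∣ (Y Δ X) [ w ]≔ (lookup Y w xor false) ∣      ≡⟨ cong (suc ∘ ∣_∣) (Δ-[]≔ Y X w false) ⟨
  suc ∣ Y Δ (X [ w ]≔ false) ∣                       ∎
  where
  open ≡-Reasoning
  YΔX-w : lookup (Y Δ X) w ≡ true
  YΔX-w = trans (lookup-Δ Y X w) (cong₂ _xor_ Yw Xw)
  Y-w : false ≡ lookup Y w xor false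
  Y-w = sym (trans (xor-identityʳ _) Yw)

∣insertAt∣ : ∀ {n} (x : Subset n) u t → ∣ insertAt x u t ∣ ≡ bit t + ∣ x ∣
∣insertAt∣ x       zero    t = ∣∷∣ t x
∣insertAt∣ (a ∷ x) (suc u) t = begin
  ∣ a ∷ insertAt x u t ∣      ≡⟨ ∣∷∣ a (insertAt x u t) ⟩
  bit a + ∣ insertAt x u t ∣  ≡⟨ cong (bit a +_) (∣insertAt∣ x u t) ⟩
  bit a + (bit t + ∣ x ∣)     ≡⟨ x∙yz≈y∙xz (bit a) (bit t) ∣ x ∣ ⟩
  bit t + (bit a + ∣ x ∣)     ≡⟨ cong (bit t +_) (∣∷∣ a x) ⟨
  bit t + ∣ a ∷ x ∣           ∎
  where open ≡-Reasoning

insertAt-[]≔ : ∀ {n} (x : Subset n) u t s → insertAt x u t [ u ]≔ s ≡ insertAt x u s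
insertAt-[]≔ x       zero    t s = refl
insertAt-[]≔ (a ∷ x) (suc u) t s = cong (a ∷_) (insertAt-[]≔ x u t s)

module SubsetSum {c ℓ} (M : CommutativeMonoid c ℓ) where

  open CommutativeMonoid M
    using (Carrier; _≈_; _∙_; ε; ∙-cong; assoc; comm; identityʳ; setoid; commutativeSemigroup)
    renaming (refl to ≈-refl; sym to ≈-sym; trans to ≈-trans)
  open import Algebra.Properties.CommutativeSemigroup commutativeSemigroup using (interchange)
  open import Relation.Binary.Reasoning.Setoid setoid
  import Relation.Binary.PropositionalEquality as Eq

  ∑ : ∀ n → (Subset n → Carrier) → Carrier
  ∑ zero    f = f []
  ∑ (suc n) f = ∑ n (f ∘ (true ∷_)) ∙ ∑ n (f ∘ (false ∷_))

  ∑-cong : ∀ n {f g : Subset n → Carrier} → (∀ x → f x ≈ g x) → ∑ n f ≈ ∑ n g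
  ∑-cong zero    f≈g = f≈g []
  ∑-cong (suc n) f≈g = ∙-cong (∑-cong n (f≈g ∘ (true ∷_))) (∑-cong n (f≈g ∘ (false ∷_)))

  ∑-distrib : ∀ n (f g : Subset n → Carrier) → ∑ n (λ x → f x ∙ g x) ≈ ∑ n f ∙ ∑ n g
  ∑-distrib zero    f g = ≈-refl
  ∑-distrib (suc n) f g = begin
    ∑ n (λ x → f (true ∷ x) ∙ g (true ∷ x)) ∙ ∑ n (λ x → f (false ∷ x) ∙ g (false ∷ x))
      ≈⟨ ∙-cong (∑-distrib n _ _) (∑-distrib n _ _) ⟩
    (∑ n (f ∘ (true ∷_)) ∙ ∑ n (g ∘ (true ∷_))) ∙ (∑ n (f ∘ (false ∷_)) ∙ ∑ n (g ∘ (false ∷_)))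
      ≈⟨ interchange _ _ _ _ ⟩
    ∑ (suc n) f ∙ ∑ (suc n) g ∎

  ∑-Δ : ∀ n (c : Subset n) (f : Subset n → Carrier) → ∑ n (λ x → f (x Δ c)) ≈ ∑ n f
  ∑-Δ zero    []          f = ≈-refl
  ∑-Δ (suc n) (false ∷ c) f = ∙-cong (∑-Δ n c (f ∘ (true ∷_))) (∑-Δ n c (f ∘ (false ∷_)))
  ∑-Δ (suc n) (true ∷ c)  f =
    ≈-trans (∙-cong (∑-Δ n c (f ∘ (false ∷_))) (∑-Δ n c (f ∘ (true ∷_)))) (comm _ _)

  ∑-insertAt : ∀ n u (f : Subset (suc n) → Carrier) →
               ∑ (suc n) f ≈ ∑ n (λ x → f (insertAt x u true)) ∙ ∑ n (λ x → f (insertAt x u false))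
  ∑-insertAt n       zero    f = ≈-refl
  ∑-insertAt (suc n) (suc u) f = begin
    ∑ (suc n) (f ∘ (true ∷_)) ∙ ∑ (suc n) (f ∘ (false ∷_))
      ≈⟨ ∙-cong (∑-insertAt n u (f ∘ (true ∷_))) (∑-insertAt n u (f ∘ (false ∷_))) ⟩
    (∑ n (λ x → f (true ∷ insertAt x u true)) ∙ ∑ n (λ x → f (true ∷ insertAt x u false))) ∙
    (∑ n (λ x → f (false ∷ insertAt x u true)) ∙ ∑ n (λ x → f (false ∷ insertAt x u false)))
      ≈⟨ interchange _ _ _ _ ⟩
    ∑ (suc n) (λ x → f (insertAt x (suc u) true)) ∙ ∑ (suc n) (λ x → f (insertAt x (suc u) false)) ∎

  -- A bijection, since c only reads x [ w ]≔ false.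
  ∑-shear : ∀ n w (c : Subset n → Bool) (f : Subset n → Carrier) →
            ∑ n (λ x → f (x [ w ]≔ (lookup x w xor c (x [ w ]≔ false)))) ≈ ∑ n f
  ∑-shear (suc n) w c f = begin
    ∑ (suc n) (f ∘ shear)
      ≈⟨ ∑-insertAt n w (f ∘ shear) ⟩
    ∑ n (λ x → f (shear (insertAt x w true))) ∙ ∑ n (λ x → f (shear (insertAt x w false)))
      ≈⟨ ∑-distrib n _ _ ⟨
    ∑ n (λ x → f (shear (insertAt x w true)) ∙ f (shear (insertAt x w false)))
      ≈⟨ ∑-cong n shift ⟩
    ∑ n (λ x → f (insertAt x w true) ∙ f (insertAt x w false))
      ≈⟨ ∑-distrib n _ _ ⟩
    ∑ n (λ x → f (insertAt x w true)) ∙ ∑ n (λ x → f (insertAt x w false))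
      ≈⟨ ∑-insertAt n w f ⟨
    ∑ (suc n) f ∎
    where
    shear : Subset (suc n) → Subset (suc n)
    shear x = x [ w ]≔ (lookup x w xor c (x [ w ]≔ false))
    shear-insertAt : ∀ t x → shear (insertAt x w t) ≡ insertAt x w (t xor c (insertAt x w false))
    shear-insertAt t x rewrite insertAt-lookup x w t | insertAt-[]≔ x w t false =
      insertAt-[]≔ x w t _
    shift : ∀ x → f (shear (insertAt x w true)) ∙ f (shear (insertAt x w false)) ≈
                  f (insertAt x w true) ∙ f (insertAt x w false)
    shift x rewrite shear-insertAt true x | shear-insertAt false x with c (insertAt x w false)
    ... | false = ≈-refl
    ... | true  = comm _ _

  ∑-ε : ∀ n → ∑ n (λ _ → ε) ≈ ε
  ∑-ε zero    = ≈-refl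
  ∑-ε (suc n) = ≈-trans (∙-cong (∑-ε n) (∑-ε n)) (identityʳ ε)

  ∑-hom : ∀ n (h : Carrier → Carrier) → (∀ {a b} → a ≈ b → h a ≈ h b) →
          (∀ a b → h (a ∙ b) ≈ h a ∙ h b) → ∀ f → ∑ n (h ∘ f) ≈ h (∑ n f)
  ∑-hom zero    h h-cong h-hom f = ≈-refl
  ∑-hom (suc n) h h-cong h-hom f =
    ≈-trans (∙-cong (∑-hom n h h-cong h-hom _) (∑-hom n h h-cong h-hom _)) (≈-sym (h-hom _ _))

  foldr-allSubsets : ∀ n (f : Subset n → Carrier) b → foldr _∙_ b (map f (allSubsets n)) ≈ ∑ n f ∙ b
  foldr-allSubsets zero    f b = ≈-refl
  foldr-allSubsets (suc n) f b = begin
    foldr _∙_ b (map f (map (true ∷_) S ++ map (false ∷_) S))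
      ≡⟨ Eq.cong (foldr _∙_ b) (map-++ f (map (true ∷_) S) _) ⟩
    foldr _∙_ b (map f (map (true ∷_) S) ++ map f (map (false ∷_) S))
      ≡⟨ foldr-++ _∙_ b (map f (map (true ∷_) S)) _ ⟩
    foldr _∙_ (foldr _∙_ b (map f (map (false ∷_) S))) (map f (map (true ∷_) S))
      ≡⟨ Eq.cong₂ (λ xs ys → foldr _∙_ (foldr _∙_ b ys) xs) (map-∘ S) (map-∘ S) ⟨
    foldr _∙_ (foldr _∙_ b (map (f ∘ (false ∷_)) S)) (map (f ∘ (true ∷_)) S)
      ≈⟨ foldr-allSubsets n (f ∘ (true ∷_)) _ ⟩
    ∑ n (f ∘ (true ∷_)) ∙ foldr _∙_ b (map (f ∘ (false ∷_)) S)
      ≈⟨ ∙-cong ≈-refl (foldr-allSubsets n (f ∘ (false ∷_)) b) ⟩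
    ∑ n (f ∘ (true ∷_)) ∙ (∑ n (f ∘ (false ∷_)) ∙ b)
      ≈⟨ assoc _ _ _ ⟨
    ∑ (suc n) f ∙ b ∎
    where S = allSubsets n

  ∑≈foldr : ∀ n (f : Subset n → Carrier) → foldr _∙_ ε (map f (allSubsets n)) ≈ ∑ n f
  ∑≈foldr n f = ≈-trans (foldr-allSubsets n f ε) (identityʳ _)

_·_ : ∀ {n} → (Fin n → Bool) → Subset n → Bool
a · x = sumFin _ (λ j → a j ∧ lookup x j)

infix 8 _·_

module _ {n : ℕ} where

  ·-congˡ : {a b : Fin n → Bool} → (∀ j → a j ≡ b j) → ∀ x → a · x ≡ b · x
  ·-congˡ a≗b x = sumFin-cong (λ j → cong (_∧ lookup x j) (a≗b j))

  ·-Δ : ∀ (a : Fin n → Bool) x y → a · (x Δ y) ≡ a · x xor a · y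
  ·-Δ a x y = trans
    (sumFin-cong (λ j → trans (cong (a j ∧_) (lookup-Δ x y j)) (∧-distribˡ-xor (a j) _ _)))
    (sumFin-xor (λ j → a j ∧ lookup x j) (λ j → a j ∧ lookup y j))

  ·-xorˡ : ∀ (a b : Fin n → Bool) x → (λ j → a j xor b j) · x ≡ a · x xor b · x
  ·-xorˡ a b x = trans (sumFin-cong (λ j → ∧-distribʳ-xor (lookup x j) (a j) (b j)))
                     (sumFin-xor (λ j → a j ∧ lookup x j) (λ j → b j ∧ lookup x j))

  ·-∧ˡ : ∀ c (a : Fin n → Bool) x → (λ j → c ∧ a j) · x ≡ c ∧ a · x
  ·-∧ˡ c a x = trans (sumFin-cong (λ j → ∧-assoc c (a j) (lookup x j))) (sumFin-∧ˡ c (λ j → a j ∧ lookup x j))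

  ·-zeroˡ : ∀ {a : Fin n → Bool} → (∀ j → a j ≡ false) → ∀ x → a · x ≡ false
  ·-zeroˡ a≗0 x = sumFin-zero _ (λ j → cong (_∧ lookup x j) (a≗0 j))

  ·-⊥ : ∀ (a : Fin n → Bool) → a · ∅ ≡ false
  ·-⊥ a = sumFin-zero _ (λ j → trans (cong (a j ∧_) (lookup-replicate j false)) (∧-zeroʳ (a j)))

·-[]≔false : ∀ {n} (a : Fin n → Bool) y w → a · y ≡ a · (y [ w ]≔ false) xor (a w ∧ lookup y w)
·-[]≔false a (b ∷ y) zero    =
  solve 3 (λ a₀ b r → (a₀ :* b) :+ r := ((a₀ :* con false) :+ r) :+ (a₀ :* b)) refl (a zero) b ((a ∘ suc) · y)
  where open xor-∧-Solver
·-[]≔false a (b ∷ y) (suc w) = begin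
  (a zero ∧ b) xor (a ∘ suc) · y
    ≡⟨ cong ((a zero ∧ b) xor_) (·-[]≔false (a ∘ suc) y w) ⟩
  (a zero ∧ b) xor ((a ∘ suc) · (y [ w ]≔ false) xor (a (suc w) ∧ lookup y w))
    ≡⟨ xor-assoc (a zero ∧ b) _ _ ⟨
  ((a zero ∧ b) xor (a ∘ suc) · (y [ w ]≔ false)) xor (a (suc w) ∧ lookup y w) ∎
  where open ≡-Reasoning

·-[]≔ : ∀ {n} (a : Fin n → Bool) y w s → a · (y [ w ]≔ s) ≡ a · y xor (a w ∧ (lookup y w xor s))
·-[]≔ a y w s = begin
  a · (y [ w ]≔ s)
    ≡⟨ ·-[]≔false a (y [ w ]≔ s) w ⟩
  a · ((y [ w ]≔ s) [ w ]≔ false) xor (a w ∧ lookup (y [ w ]≔ s) w)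
    ≡⟨ cong₂ (λ z b → a · z xor (a w ∧ b)) ([]≔-idempotent y w) (lookup∘update w y s) ⟩
  a · (y [ w ]≔ false) xor (a w ∧ s)
    ≡⟨ solve 4 (λ m c b s → m :+ (c :* s) := (m :+ (c :* b)) :+ (c :* (b :+ s)))
             refl (a · (y [ w ]≔ false)) (a w) (lookup y w) s ⟩
  (a · (y [ w ]≔ false) xor (a w ∧ lookup y w)) xor (a w ∧ (lookup y w xor s))
    ≡⟨ cong (_xor (a w ∧ (lookup y w xor s))) (·-[]≔false a y w) ⟨
  a · y xor (a w ∧ (lookup y w xor s)) ∎
  where
  open ≡-Reasoning
  open xor-∧-Solver

·-insertAt : ∀ {n} (a : Fin (suc n) → Bool) x u t → a · insertAt x u t ≡ (a u ∧ t) xor (a ∘ punchIn u) · x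
·-insertAt a x u t = trans (sumFin-punchIn u (λ j → a j ∧ lookup (insertAt x u t) j))
  (cong₂ _xor_ (cong (a u ∧_) (insertAt-lookup x u t))
               (sumFin-cong (λ j → cong (a (punchIn u j) ∧_) (insertAt-punchIn x u t j))))

·-zero-on-support : ∀ {n} (a : Fin n → Bool) y → (∀ j → lookup y j ≡ true → a j ≡ false) → a · y ≡ false
·-zero-on-support a y a⊥y = sumFin-zero (λ j → a j ∧ lookup y j) λ j → vanish (lookup y j) (a⊥y j)
  where
  vanish : ∀ {c} b → (b ≡ true → c ≡ false) → c ∧ b ≡ false
  vanish {c} false _ = ∧-zeroʳ c
  vanish     true  h = cong (_∧ true) (h refl)

·-sym : ∀ {n} (G : Matrix n) → Symmetric G → ∀ x z → (λ i → G i · z) · x ≡ (λ j → G j · x) · z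
·-sym {n} G G-sym x z = begin
  sumFin n (λ i → (G i · z) ∧ lookup x i)
    ≡⟨ sumFin-cong (λ i → trans (∧-comm (G i · z) _) (sym (sumFin-∧ˡ (lookup x i) (terms z i)))) ⟩
  sumFin n (λ i → sumFin n (λ j → lookup x i ∧ (G i j ∧ lookup z j)))
    ≡⟨ sumFin-comm (λ i j → lookup x i ∧ (G i j ∧ lookup z j)) ⟩
  sumFin n (λ j → sumFin n (λ i → lookup x i ∧ (G i j ∧ lookup z j)))
    ≡⟨ sumFin-cong (λ j → sumFin-cong (λ i → swap (lookup x i) (lookup z j) (G-sym i j))) ⟩
  sumFin n (λ j → sumFin n (λ i → lookup z j ∧ (G j i ∧ lookup x i)))
    ≡⟨ sumFin-cong (λ j → trans (sumFin-∧ˡ (lookup z j) (terms x j)) (∧-comm (lookup z j) (G j · x))) ⟩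
  sumFin n (λ j → (G j · x) ∧ lookup z j) ∎
  where
  open ≡-Reasoning
  terms : Subset n → Fin n → Fin n → Bool
  terms y i j = G i j ∧ lookup y j
  swap : ∀ a b {g h} → g ≡ h → a ∧ (g ∧ b) ≡ b ∧ (h ∧ a)
  swap a b {g} refl = solve 3 (λ a b g → a :* (g :* b) := b :* (g :* a)) refl a b g
    where open xor-∧-Solver

-- Kernels of principal submatrices

InKernel : ∀ {n} → Matrix n → Subset n → Subset n → Set
InKernel G X x = x ⊑ X × (∀ i → lookup X i ≡ true → G i · x ≡ false)

allFin-≡-true : ∀ n (f : Fin n → Bool) → allFin n f ≡ true ⇔ (∀ i → f i ≡ true)
allFin-≡-true zero    f = mk⇔ (λ _ ()) (λ _ → refl)
allFin-≡-true (suc n) f = mk⇔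
  (λ h → λ { zero → proj₁ (∧-≡-true h) ; (suc i) → to (proj₂ (∧-≡-true h)) i })
  (λ h → cong₂ _∧_ (h zero) (from (h ∘ suc)))
  where open Equivalence (allFin-≡-true n (f ∘ suc))

not∨-≡-true : ∀ {a b} → not a ∨ b ≡ true ⇔ (a ≡ true → b ≡ true)
not∨-≡-true {false} = mk⇔ (λ _ ()) (λ _ → refl)
not∨-≡-true {true}  = mk⇔ (λ h _ → h) (λ h → h refl)

not∨not-≡-true : ∀ {a b} → not a ∨ not b ≡ true ⇔ (a ≡ true → b ≡ false)
not∨not-≡-true {false}         = mk⇔ (λ _ ()) (λ _ → refl)
not∨not-≡-true {true} {false} = mk⇔ (λ _ _ → refl) (λ _ → refl)
not∨not-≡-true {true} {true}  = mk⇔ (λ ()) (λ h → ⊥-elim (true≢false (h refl)))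

inKernel⇔ : ∀ {n} (G : Matrix n) X x → inKernel G X x ≡ true ⇔ InKernel G X x
inKernel⇔ {n} G X x = mk⇔
  (λ h → (λ j → to not∨-≡-true (to (allFin-≡-true n _) (proj₁ (∧-≡-true h)) j))
       , (λ i → to not∨not-≡-true (to (allFin-≡-true n _) (proj₂ (∧-≡-true h)) i)))
  (λ (x⊑X , Gx) → cong₂ _∧_ (from (allFin-≡-true n _) (λ j → from not∨-≡-true (x⊑X j)))
                            (from (allFin-≡-true n _) (λ i → from not∨not-≡-true (Gx i))))
  where open Equivalence

inKernel-cong : ∀ {n m} (G : Matrix n) X x (H : Matrix m) Y y →
                InKernel G X x ⇔ InKernel H Y y → inKernel G X x ≡ inKernel H Y y
inKernel-cong G X x H Y y G⇔H = ≡-by-truth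
  (from (inKernel⇔ H Y y) ∘ to G⇔H ∘ to (inKernel⇔ G X x))
  (from (inKernel⇔ G X x) ∘ from G⇔H ∘ to (inKernel⇔ H Y y))
  where open Equivalence

module _ {n : ℕ} (G : Matrix n) (X : Subset n) where

  InKernel-∅ : InKernel G X ∅
  InKernel-∅ = (λ j ∅j → ⊥-elim (true≢false (trans (sym ∅j) (lookup-replicate j false))))
             , (λ i _ → ·-⊥ (G i))

  InKernel-Δ : ∀ x y → InKernel G X x → InKernel G X y → InKernel G X (x Δ y)
  InKernel-Δ x y (x⊑X , Gx) (y⊑X , Gy) =
    (λ j h → either (x⊑X j) (y⊑X j) (trans (sym (lookup-Δ x y j)) h))
    , (λ i Xi → trans (·-Δ (G i) x y) (cong₂ _xor_ (Gx i Xi) (Gy i Xi)))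
    where
    either : ∀ {a b c} → (a ≡ true → c ≡ true) → (b ≡ true → c ≡ true) → a xor b ≡ true → c ≡ true
    either {false} _ g h = g h
    either {true}  f _ _ = f refl

  inKernel-Δ : ∀ c → inKernel G X c ≡ true → ∀ x → inKernel G X (x Δ c) ≡ inKernel G X x
  inKernel-Δ c c∈K′ x = ≡-by-truth
    (λ h → from (inKernel⇔ G X x)
                (subst (InKernel G X) (Δ-cancelʳ x c) (InKernel-Δ (x Δ c) c (to (inKernel⇔ G X (x Δ c)) h) c∈K)))
    (λ h → from (inKernel⇔ G X (x Δ c)) (InKernel-Δ x c (to (inKernel⇔ G X x) h) c∈K))
    where
    open Equivalence
    c∈K = to (inKernel⇔ G X c) c∈K′

module ℕSum = SubsetSum ℕ.+-0-commutativeMonoid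
module ℤSum = SubsetSum ℤ.+-0-commutativeMonoid

count : ∀ n → (Subset n → Bool) → ℕ
count n p = ℕSum.∑ n (bit ∘ p)

count-cong : ∀ n {p q : Subset n → Bool} → (∀ x → p x ≡ q x) → count n p ≡ count n q
count-cong n p≗q = ℕSum.∑-cong n (cong bit ∘ p≗q)

count-mono : ∀ n {p q : Subset n → Bool} → (∀ x → p x ≡ true → q x ≡ true) → count n p ≤ count n q
count-mono zero    {p} p⇒q with p [] in eq
... | false = z≤n
... | true  rewrite p⇒q [] eq = ℕ.≤-refl
count-mono (suc n)     p⇒q = ℕ.+-mono-≤ (count-mono n (p⇒q ∘ (true ∷_))) (count-mono n (p⇒q ∘ (false ∷_)))

count-false : ∀ n {p : Subset n → Bool} → (∀ x → p x ≡ false) → count n p ≡ 0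
count-false n p≗false = trans (count-cong n p≗false) (ℕSum.∑-ε n)

count-pos : ∀ n {p : Subset n → Bool} x → p x ≡ true → 1 ≤ count n p
count-pos zero    []          px rewrite px = ℕ.≤-refl
count-pos (suc n) (true ∷ x)  px = ℕ.≤-trans (count-pos n x px) (ℕ.m≤m+n _ _)
count-pos (suc n) (false ∷ x) px = ℕ.≤-trans (count-pos n x px) (ℕ.m≤n+m _ _)

count-head : ∀ n {p : Subset (suc n) → Bool} b → (∀ x → p (not b ∷ x) ≡ false) →
             count (suc n) p ≡ count n (p ∘ (b ∷_))
count-head n {p} true  other = trans (cong (count n (p ∘ (true ∷_)) +_) (count-false n other)) (ℕ.+-identityʳ _)
count-head n {p} false other = cong (_+ count n (p ∘ (false ∷_))) (count-false n other)

count-unique : ∀ n {p : Subset n → Bool} c → (∀ x → p x ≡ true → x ≡ c) → count n p ≤ 1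
count-unique zero    {p} [] _ with p []
... | false = z≤n
... | true  = ℕ.≤-refl
count-unique (suc n) {p} (b ∷ c) unique = begin
  count (suc n) p       ≡⟨ count-head n {p} b (λ x → ¬-not (other-head x)) ⟩
  count n (p ∘ (b ∷_))  ≤⟨ count-unique n c (λ x px → ∷-injectiveʳ (unique _ px)) ⟩
  1                     ∎
  where
  open ℕ.≤-Reasoning
  other-head : ∀ x → p (not b ∷ x) ≢ true
  other-head x px = not-¬ refl (sym (∷-injectiveˡ (unique _ px)))

count-split : ∀ n (p r : Subset n → Bool) →
              count n p ≡ count n (λ x → p x ∧ r x) + count n (λ x → p x ∧ not (r x))
count-split n p r = trans (ℕSum.∑-cong n (λ x → bit-split (p x) (r x))) (ℕSum.∑-distrib n _ _)
  where
  bit-split : ∀ a b → bit a ≡ bit (a ∧ b) + bit (a ∧ not b)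
  bit-split false _     = refl
  bit-split true  false = refl
  bit-split true  true  = refl

count-insertAt : ∀ n u (p : Subset (suc n) → Bool) →
                 count (suc n) p ≡ count n (λ x → p (insertAt x u true)) + count n (λ x → p (insertAt x u false))
count-insertAt n u p = ℕSum.∑-insertAt n u (bit ∘ p)

count-xnor : ∀ n (f q : Subset n → Bool) →
             count n (λ x → not (true xor f x) ∧ q x) + count n (λ x → not (false xor f x) ∧ q x) ≡ count n q
count-xnor n f q = trans (sym (ℕSum.∑-distrib n _ _)) (ℕSum.∑-cong n (λ x → one-of (f x) (q x)))
  where
  one-of : ∀ b c → bit (not (true xor b) ∧ c) + bit (not (false xor b) ∧ c) ≡ bit c
  one-of false false = refl
  one-of false true  = refl
  one-of true  false = refl
  one-of true  true  = refl

count-insertAt-graph : ∀ n u (p : Subset (suc n) → Bool) (f q : Subset n → Bool) →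
              (∀ t x → p (insertAt x u t) ≡ true ⇔ (t ≡ f x × q x ≡ true)) → count (suc n) p ≡ count n q
count-insertAt-graph n u p f q p⇔ = begin
  count (suc n) p
    ≡⟨ count-insertAt n u p ⟩
  count n (λ x → p (insertAt x u true)) + count n (λ x → p (insertAt x u false))
    ≡⟨ cong₂ _+_ (count-cong n (as-bool true)) (count-cong n (as-bool false)) ⟩
  count n (λ x → not (true xor f x) ∧ q x) + count n (λ x → not (false xor f x) ∧ q x)
    ≡⟨ count-xnor n f q ⟩
  count n q ∎
  where
  open ≡-Reasoning
  open Equivalence
  as-bool : ∀ t x → p (insertAt x u t) ≡ not (t xor f x) ∧ q x
  as-bool t x = ≡-by-truth
    (λ h → let (t≡fx , qx) = to (p⇔ t x) h in
      trans (cong₂ (λ a b → not (a xor f x) ∧ b) t≡fx qx) (cong (λ b → not b ∧ true) (xor-same (f x))))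
    (λ h → from (p⇔ t x) (xor-≡-false (not-≡-true (proj₁ (∧-≡-true h))) , proj₂ (∧-≡-true h)))

count-insertAt-constant : ∀ n u (p : Subset (suc n) → Bool) (q : Subset n → Bool) →
             (∀ t x → p (insertAt x u t) ≡ q x) → count (suc n) p ≡ count n q + count n q
count-insertAt-constant n u p q p≗q = trans (count-insertAt n u p) (cong₂ _+_ (count-cong n (p≗q true)) (count-cong n (p≗q false)))

count-shear : ∀ n w (c p : Subset n → Bool) →
              count n (λ x → p (x [ w ]≔ (lookup x w xor c (x [ w ]≔ false)))) ≡ count n p
count-shear n w c p = ℕSum.∑-shear n w c (bit ∘ p)

-- (t , x) with lookup x w ≡ false ↦ x [ w ]≔ (t xor f x) is a bijection onto Subset n.
count-move-coordinate : ∀ n u w (p : Subset (suc n) → Bool) (f q : Subset n → Bool) →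
  (∀ x b → f (x [ w ]≔ b) ≡ f x) →
  (∀ t x → p (insertAt x u t) ≡ not (lookup x w) ∧ q (x [ w ]≔ (t xor f x))) → count (suc n) p ≡ count n q
count-move-coordinate n u w p f q f-local p≡ = begin
  count (suc n) p
    ≡⟨ count-insertAt n u p ⟩
  count n (λ x → p (insertAt x u true)) + count n (λ x → p (insertAt x u false))
    ≡⟨ cong₂ _+_ (moved true) (moved false) ⟩
  count n (g true) + count n (g false)
    ≡⟨ count-xnor n (λ y → lookup y w xor f y) q ⟩
  count n q ∎
  where
  open ≡-Reasoning
  g : Bool → Subset n → Bool
  g t y = not (t xor (lookup y w xor f y)) ∧ q y
  shear : Bool → Subset n → Subset n
  shear t x = x [ w ]≔ (lookup x w xor (t xor f (x [ w ]≔ false)))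
  cancel : ∀ b t c → not (t xor ((b xor (t xor c)) xor c)) ≡ not b
  cancel = solve 3 (λ b t c → con true :+ (t :+ ((b :+ (t :+ c)) :+ c)) := con true :+ b) refl
    where open xor-∧-Solver
  pointwise : ∀ t x → p (insertAt x u t) ≡ g t (shear t x)
  pointwise t x rewrite p≡ t x | f-local x false | lookup∘update w x (lookup x w xor (t xor f x))
                      | f-local x (lookup x w xor (t xor f x)) with lookup x w
  ... | false = cong (_∧ q (x [ w ]≔ (t xor f x))) (sym (cancel false t (f x)))
  ... | true  = cong (_∧ q (x [ w ]≔ (not (t xor f x)))) (sym (cancel true t (f x)))
  moved : ∀ t → count n (λ x → p (insertAt x u t)) ≡ count n (g t)
  moved t = trans (count-cong n (pointwise t)) (count-shear n w (λ z → t xor f z) (g t))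

search : ∀ n (p : Subset n → Bool) → (∃ λ x → p x ≡ true) ⊎ (∀ x → p x ≡ false)
search n p with anySubset? (λ x → p x Bool.≟ true)
... | yes found = inj₁ found
... | no  none  = inj₂ (λ x → ¬-not (λ px → none (x , px)))

-- Translation by c exchanges the two halves.
module _ n (S r : Subset n → Bool)
         (S-closed : ∀ c → S c ≡ true → ∀ x → S (x Δ c) ≡ S x)
         (r-hom : ∀ x c → r (x Δ c) ≡ r x xor r c) where

  count-halves : ∀ c → S c ≡ true → r c ≡ true →
                 count n (λ x → S x ∧ r x) ≡ count n (λ x → S x ∧ not (r x))
  count-halves c Sc rc = begin
    count n (λ x → S x ∧ r x)              ≡⟨ ℕSum.∑-Δ n c (λ x → bit (S x ∧ r x)) ⟨
    count n (λ x → S (x Δ c) ∧ r (x Δ c))  ≡⟨ count-cong n (λ x → cong₂ _∧_ (S-closed c Sc x) (flip x)) ⟩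
    count n (λ x → S x ∧ not (r x))        ∎
    where
    open ≡-Reasoning
    flip : ∀ x → r (x Δ c) ≡ not (r x)
    flip x = trans (r-hom x c) (trans (cong (r x xor_) rc) (xor-comm (r x) true))

  count-half : count n (λ x → S x ∧ r x) ≤ count n (λ x → S x ∧ not (r x))
  count-half with search n (λ x → S x ∧ r x)
  ... | inj₂ none = ℕ.≤-trans (ℕ.≤-reflexive (count-false n none)) z≤n
  ... | inj₁ (c , Sc∧rc) = let (Sc , rc) = ∧-≡-true Sc∧rc in ℕ.≤-reflexive (count-halves c Sc rc)

length-filterᵇ : ∀ {A : Set} (p : A → Bool) xs → length (filterᵇ p xs) ≡ foldr _+_ 0 (map (bit ∘ p) xs)
length-filterᵇ p []       = refl
length-filterᵇ p (x ∷ xs) with p x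
... | true  = cong suc (length-filterᵇ p xs)
... | false = length-filterᵇ p xs

kernelSize≡count : ∀ {n} (G : Matrix n) X → kernelSize G X ≡ count n (inKernel G X)
kernelSize≡count {n} G X = trans (length-filterᵇ (inKernel G X) (allSubsets n)) (ℕSum.∑≈foldr n _)

-- Nullities of principal submatrices

kernelSize-pos : ∀ {n} (G : Matrix n) X → 1 ≤ kernelSize G X
kernelSize-pos {n} G X = subst (1 ≤_) (sym (kernelSize≡count G X))
  (count-pos n ∅ (Equivalence.from (inKernel⇔ G X ∅) (InKernel-∅ G X)))

-- Vectors of ker G[X] on which an additive r vanishes form half of it or all of it.
kernelSize-≤-double : ∀ {n} (G : Matrix n) X Y (r : Subset n → Bool) → (∀ x c → r (x Δ c) ≡ r x xor r c) →
                      (∀ x → InKernel G X x → r x ≡ false → InKernel G Y x) →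
                      kernelSize G X ≤ kernelSize G Y + kernelSize G Y
kernelSize-≤-double {n} G X Y r r-hom ker⇒ = begin
  kernelSize G X                                          ≡⟨ kernelSize≡count G X ⟩
  count n (inKernel G X)                                  ≡⟨ count-split n (inKernel G X) r ⟩
  count n (λ x → inKernel G X x ∧ r x) + count n K¬r      ≤⟨ ℕ.+-monoˡ-≤ _ half ⟩
  count n K¬r + count n K¬r                               ≤⟨ ℕ.+-mono-≤ K¬r≤ K¬r≤ ⟩
  count n (inKernel G Y) + count n (inKernel G Y)         ≡⟨ cong₂ _+_ (kernelSize≡count G Y) (kernelSize≡count G Y) ⟨
  kernelSize G Y + kernelSize G Y                         ∎
  where
  open ℕ.≤-Reasoning
  open Equivalence
  K¬r : Subset n → Bool
  K¬r x = inKernel G X x ∧ not (r x)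
  half = count-half n (inKernel G X) r (inKernel-Δ G X) r-hom
  K¬r≤ : count n K¬r ≤ count n (inKernel G Y)
  K¬r≤ = count-mono n λ x h → let (x∈K , ¬rx) = ∧-≡-true h in
    from (inKernel⇔ G Y x) (ker⇒ x (to (inKernel⇔ G X x) x∈K) (not-≡-true ¬rx))

kernelSize-[]≔ : ∀ {n} (G : Matrix n) X w b →
                 kernelSize G (X [ w ]≔ b) ≤ kernelSize G (X [ w ]≔ not b) + kernelSize G (X [ w ]≔ not b)
kernelSize-[]≔ G X w true =
  kernelSize-≤-double G (X [ w ]≔ true) (X [ w ]≔ false) (λ x → lookup x w) (λ x c → lookup-Δ x c w)
    λ x (x⊑X , Gx) xw≡false →
        subst (x ⊑_) ([]≔-idempotent X w) (⊑-drop {x = x} {X [ w ]≔ true} w x⊑X xw≡false)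
      , (λ i → Gx i ∘ []≔false-⊑[]≔ X w true i)
kernelSize-[]≔ G X w false =
  kernelSize-≤-double G (X [ w ]≔ false) (X [ w ]≔ true) (G w ·_) (·-Δ (G w))
    λ x (x⊑X , Gx) Gwx≡false → (λ j → []≔false-⊑[]≔ X w true j ∘ x⊑X j) , rows {x} Gx Gwx≡false
  where
  rows : ∀ {x} → (∀ i → lookup (X [ w ]≔ false) i ≡ true → G i · x ≡ false) → G w · x ≡ false →
         ∀ i → lookup (X [ w ]≔ true) i ≡ true → G i · x ≡ false
  rows Gx Gwx i Xi with i ≟ w
  ... | yes refl = Gwx
  ... | no  i≢w  = Gx i (lookup-[]≔⁺ X false i≢w (lookup-[]≔⁻ X true i≢w Xi))

-- By symmetry of G, (G z)_w = x · G z = z · G x = 0.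
·-vanishes-on-smaller-kernel : ∀ {n} (G : Matrix n) → Symmetric G → ∀ X x z w →
  InKernel G X x → lookup x w ≡ true → InKernel G (X [ w ]≔ false) z → G w · z ≡ false
·-vanishes-on-smaller-kernel G G-sym X x z w (x⊑X , Gx) xw (z⊑X₀ , Gz) = begin
  G w · z                                              ≡⟨ ∧-identityʳ _ ⟨
  (G w · z) ∧ true                                     ≡⟨ cong ((G w · z) ∧_) xw ⟨
  (G w · z) ∧ lookup x w                               ≡⟨ cong (_xor ((G w · z) ∧ lookup x w)) rest≡false ⟨
  G*z · (x [ w ]≔ false) xor ((G w · z) ∧ lookup x w)  ≡⟨ ·-[]≔false G*z x w ⟨
  G*z · x                                              ≡⟨ ·-sym G G-sym x z ⟩
  (λ j → G j · x) · z                                  ≡⟨ ·-zero-on-support _ z (λ j → Gx j ∘ z⊑X j) ⟩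
  false                                                ∎
  where
  open ≡-Reasoning
  G*z : Fin _ → Bool
  G*z i = G i · z
  z⊑X : z ⊑ X
  z⊑X j = []≔false-⊑ X w j ∘ z⊑X₀ j
  rest≡false : G*z · (x [ w ]≔ false) ≡ false
  rest≡false = ·-zero-on-support G*z (x [ w ]≔ false) (λ i → Gz i ∘ []≔-⊑ x X w (λ ()) x⊑X i)

kernelSize-drop : ∀ {n} (G : Matrix n) → Symmetric G → ∀ X x w → InKernel G X x → lookup x w ≡ true →
                  kernelSize G X ≡ kernelSize G (X [ w ]≔ false) + kernelSize G (X [ w ]≔ false)
kernelSize-drop {n} G G-sym X x w x∈K xw = begin
  kernelSize G X                                         ≡⟨ kernelSize≡count G X ⟩
  count n (inKernel G X)                                 ≡⟨ count-split n (inKernel G X) r ⟩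
  count n (λ z → inKernel G X z ∧ r z) + count n K¬r     ≡⟨ cong (_+ count n K¬r) halves ⟩
  count n K¬r + count n K¬r                              ≡⟨ cong₂ _+_ K¬r≡ K¬r≡ ⟩
  kernelSize G X₀ + kernelSize G X₀                      ∎
  where
  open ≡-Reasoning
  open Equivalence
  X₀ = X [ w ]≔ false
  r : Subset n → Bool
  r z = lookup z w
  K¬r : Subset n → Bool
  K¬r z = inKernel G X z ∧ not (r z)
  halves = count-halves n (inKernel G X) r (inKernel-Δ G X) (λ z c → lookup-Δ z c w) x (from (inKernel⇔ G X x) x∈K) xw
  shrink : ∀ z → K¬r z ≡ true → inKernel G X₀ z ≡ true
  shrink z h = let (z∈K , ¬zw) = ∧-≡-true h ; (z⊑X , Gz) = to (inKernel⇔ G X z) z∈K in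
    from (inKernel⇔ G X₀ z) (⊑-drop {x = z} {X} w z⊑X (not-≡-true ¬zw) , λ i → Gz i ∘ []≔false-⊑ X w i)
  grow : ∀ z → inKernel G X₀ z ≡ true → K¬r z ≡ true
  grow z h = cong₂ _∧_ (from (inKernel⇔ G X z) ((λ j → []≔false-⊑ X w j ∘ z⊑X₀ j) , rows)) ¬zw
    where
    z∈K₀ = to (inKernel⇔ G X₀ z) h
    z⊑X₀ = proj₁ z∈K₀
    ¬zw : not (lookup z w) ≡ true
    ¬zw with lookup z w in zw
    ... | false = refl
    ... | true  = ⊥-elim (true≢false (trans (sym (z⊑X₀ w zw)) (lookup∘update w X false)))
    rows : ∀ i → lookup X i ≡ true → G i · z ≡ false
    rows i Xi with i ≟ w
    ... | yes refl = ·-vanishes-on-smaller-kernel G G-sym X x z w x∈K xw z∈K₀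
    ... | no  i≢w  = proj₂ z∈K₀ i (lookup-[]≔⁺ X false i≢w Xi)
  K¬r≡ : count n K¬r ≡ kernelSize G X₀
  K¬r≡ = trans (count-cong n (λ z → ≡-by-truth (shrink z) (grow z))) (sym (kernelSize≡count G X₀))

⌊log₂[m+m]⌋ : ∀ m → 1 ≤ m → ⌊log₂ (m + m) ⌋ ≡ suc ⌊log₂ m ⌋
⌊log₂[m+m]⌋ (suc m) _ = trans (cong (λ k → ⌊log₂ (suc m + k) ⌋) (sym (ℕ.+-identityʳ (suc m))))
                             (⌊log₂[2*b]⌋≡1+⌊log₂b⌋ (suc m))

nullity-[]≔ : ∀ {n} (G : Matrix n) X w b → nullity G (X [ w ]≔ b) ≤ suc (nullity G (X [ w ]≔ not b))
nullity-[]≔ G X w b = ℕ.≤-trans (⌊log₂⌋-mono-≤ (kernelSize-[]≔ G X w b))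
                                (ℕ.≤-reflexive (⌊log₂[m+m]⌋ _ (kernelSize-pos G (X [ w ]≔ not b))))

nullity-drop : ∀ {n} (G : Matrix n) → Symmetric G → ∀ X x w → InKernel G X x → lookup x w ≡ true →
               nullity G X ≡ suc (nullity G (X [ w ]≔ false))
nullity-drop G G-sym X x w x∈K xw = trans (cong ⌊log₂_⌋ (kernelSize-drop G G-sym X x w x∈K xw))
                                           (⌊log₂[m+m]⌋ _ (kernelSize-pos G (X [ w ]≔ false)))

nonsingular⇒nullity≡0 : ∀ {n} (G : Matrix n) Y → nonsingular G Y ≡ true → nullity G Y ≡ 0
nonsingular⇒nullity≡0 G Y ns = cong ⌊log₂_⌋ (ℕ.≡ᵇ⇒≡ (kernelSize G Y) 1 (subst Bool.T (sym ns) _))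

Δ-lipschitz : ∀ n (g : Subset n → ℕ) → (∀ X w b → g (X [ w ]≔ b) ≤ suc (g (X [ w ]≔ not b))) →
              ∀ X Y → g X ≤ g Y + ∣ X Δ Y ∣
Δ-lipschitz zero    g _    []      []      = ℕ.m≤m+n _ _
Δ-lipschitz (suc n) g step (a ∷ X) (b ∷ Y) = begin
  g (a ∷ X)                                ≤⟨ Δ-lipschitz n (g ∘ (a ∷_)) (λ X w → step (a ∷ X) (suc w)) X Y ⟩
  g (a ∷ Y) + ∣ X Δ Y ∣                    ≤⟨ ℕ.+-monoˡ-≤ _ (head-step a b) ⟩
  (g (b ∷ Y) + bit (a xor b)) + ∣ X Δ Y ∣  ≡⟨ ℕ.+-assoc (g (b ∷ Y)) _ _ ⟩
  g (b ∷ Y) + (bit (a xor b) + ∣ X Δ Y ∣)  ≡⟨ cong (g (b ∷ Y) +_) (∣∷∣ (a xor b) (X Δ Y)) ⟨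
  g (b ∷ Y) + ∣ (a ∷ X) Δ (b ∷ Y) ∣        ∎
  where
  open ℕ.≤-Reasoning
  head-step : ∀ a b → g (a ∷ Y) ≤ g (b ∷ Y) + bit (a xor b)
  head-step false false = ℕ.m≤m+n _ _
  head-step true  true  = ℕ.m≤m+n _ _
  head-step false true  = ℕ.≤-trans (step (true ∷ Y) zero false) (ℕ.≤-reflexive (ℕ.+-comm 1 _))
  head-step true  false = ℕ.≤-trans (step (false ∷ Y) zero true) (ℕ.≤-reflexive (ℕ.+-comm 1 _))

nullity-≤-distance : ∀ {n} (G : Matrix n) X Y → nonsingular G Y ≡ true → nullity G X ≤ ∣ Y Δ X ∣
nullity-≤-distance {n} G X Y ns = begin
  nullity G X                ≤⟨ Δ-lipschitz n (nullity G) (nullity-[]≔ G) X Y ⟩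
  nullity G Y + ∣ X Δ Y ∣    ≡⟨ cong₂ _+_ (nonsingular⇒nullity≡0 G Y ns) (cong ∣_∣ (Δ-comm X Y)) ⟩
  ∣ Y Δ X ∣                  ∎
  where open ℕ.≤-Reasoning

nonzero-kernel? : ∀ {n} (G : Matrix n) X → Dec (∃ λ x → InKernel G X x × ∃ λ w → lookup x w ≡ true)
nonzero-kernel? G X = anySubset? λ x →
  Dec.map (inKernel⇔ G X x) (inKernel G X x Bool.≟ true) ×-dec any? (λ w → lookup x w Bool.≟ true)

trivial-kernel⇒nonsingular : ∀ {n} (G : Matrix n) X → (∀ x → InKernel G X x → ∀ w → lookup x w ≢ true) →
                             nonsingular G X ≡ true
trivial-kernel⇒nonsingular {n} G X trivial = cong (ℕ._≡ᵇ 1) (ℕ.≤-antisym K≤1 (kernelSize-pos G X))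
  where
  K≤1 : kernelSize G X ≤ 1
  K≤1 = subst (_≤ 1) (sym (kernelSize≡count G X)) (count-unique n ∅ λ x h →
          Subset-ext λ w → trans (¬-not (trivial x (Equivalence.to (inKernel⇔ G X x) h) w))
                                 (sym (lookup-replicate w false)))

nonsingular-within : ∀ {n} (G : Matrix n) → Symmetric G → ∀ X →
                     ∃ λ Y → nonsingular G Y ≡ true × Y ⊑ X × ∣ Y Δ X ∣ ≡ nullity G X
nonsingular-within {n} G G-sym X = go ∣ X ∣ X refl
  where
  go : ∀ k X → ∣ X ∣ ≡ k → ∃ λ Y → nonsingular G Y ≡ true × Y ⊑ X × ∣ Y Δ X ∣ ≡ nullity G X
  go k X ∣X∣≡k with nonzero-kernel? G X
  ... | no none =
    let ns = trivial-kernel⇒nonsingular G X (λ x x∈K w xw → none (x , x∈K , w , xw)) in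
    X , ns , ⊑-refl {X = X} , trans (Δ-self X) (sym (nonsingular⇒nullity≡0 G X ns))
  ... | yes (x , x∈K , w , xw) = shrink k ∣X∣≡k
    where
    X₀ = X [ w ]≔ false
    Xw : lookup X w ≡ true
    Xw = proj₁ x∈K w xw
    ∣X∣≡1+∣X₀∣ : ∣ X ∣ ≡ suc ∣ X₀ ∣
    ∣X∣≡1+∣X₀∣ = trans (∣[]≔false∣ X w) (cong (λ b → bit b + ∣ X₀ ∣) Xw)
    shrink : ∀ k → ∣ X ∣ ≡ k → ∃ λ Y → nonsingular G Y ≡ true × Y ⊑ X × ∣ Y Δ X ∣ ≡ nullity G X
    shrink zero    ∣X∣≡0   = ⊥-elim (ℕ.0≢1+n (trans (sym ∣X∣≡0) ∣X∣≡1+∣X₀∣))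
    shrink (suc k) ∣X∣≡1+k with go k X₀ (ℕ.suc-injective (trans (sym ∣X∣≡1+∣X₀∣) ∣X∣≡1+k))
    ... | Y , ns , Y⊑X₀ , ∣YΔX₀∣≡ν = Y , ns , (λ j → []≔false-⊑ X w j ∘ Y⊑X₀ j) , (begin
      ∣ Y Δ X ∣           ≡⟨ ∣Δ[]≔false∣ Y X w Yw Xw ⟩
      suc ∣ Y Δ X₀ ∣      ≡⟨ cong suc ∣YΔX₀∣≡ν ⟩
      suc (nullity G X₀)  ≡⟨ nullity-drop G G-sym X x w x∈K xw ⟨
      nullity G X         ∎)
      where
      open ≡-Reasoning
      Yw : lookup Y w ≡ false
      Yw = ¬-not λ Yw≡true → true≢false (trans (sym (Y⊑X₀ w Yw≡true)) (lookup∘update w X false))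

∈-allSubsets : ∀ n (Y : Subset n) → Y ∈ allSubsets n
∈-allSubsets zero    []          = here refl
∈-allSubsets (suc n) (true ∷ Y)  = ∈-++⁺ˡ (∈-map⁺ (true ∷_) (∈-allSubsets n Y))
∈-allSubsets (suc n) (false ∷ Y) =
  ∈-++⁺ʳ (map (true ∷_) (allSubsets n)) (∈-map⁺ (false ∷_) (∈-allSubsets n Y))

foldr-⊓-≤ : ∀ {m} b xs → m ∈ xs → foldr _⊓_ b xs ≤ m
foldr-⊓-≤ b (x ∷ xs) (here refl) = ℕ.m⊓n≤m x _
foldr-⊓-≤ b (x ∷ xs) (there m∈) = ℕ.≤-trans (ℕ.m⊓n≤n x _) (foldr-⊓-≤ b xs m∈)

≤-foldr-⊓ : ∀ {k} b xs → (∀ {m} → m ∈ xs → k ≤ m) → k ≤ b → k ≤ foldr _⊓_ b xs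
≤-foldr-⊓ b []       _     k≤b = k≤b
≤-foldr-⊓ b (x ∷ xs) k≤xs k≤b = ℕ.⊓-glb (k≤xs (here refl)) (≤-foldr-⊓ b xs (k≤xs ∘ there) k≤b)

∈-MG⇔ : ∀ {n} (G : Matrix n) Y → Y ∈ MG G ⇔ nonsingular G Y ≡ true
∈-MG⇔ {n} G Y = mk⇔
  (λ Y∈MG → to T-≡ (proj₂ (∈-filter⁻ (Bool.T? ∘ nonsingular G) {xs = allSubsets n} Y∈MG)))
  (λ ns → ∈-filter⁺ (Bool.T? ∘ nonsingular G) (∈-allSubsets n Y) (from T-≡ ns))
  where open Equivalence

dmin-twist-MG : ∀ {n} (G : Matrix n) → Symmetric G → ∀ X → dmin (twist (MG G) X) ≡ nullity G X
dmin-twist-MG {n} G G-sym X with nonsingular-within G G-sym X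
... | Y , ns , _ , ∣YΔX∣≡ν = ℕ.≤-antisym
  (ℕ.≤-trans (foldr-⊓-≤ n distances (∈-map⁺ ∣_∣ (∈-map⁺ (_Δ X) Y∈MG))) (ℕ.≤-reflexive ∣YΔX∣≡ν))
  (≤-foldr-⊓ n distances lower (subst (_≤ n) ∣YΔX∣≡ν (∣p∣≤n (Y Δ X))))
  where
  distances = map ∣_∣ (twist (MG G) X)
  Y∈MG = Equivalence.from (∈-MG⇔ G Y) ns
  lower : ∀ {m} → m ∈ distances → nullity G X ≤ m
  lower m∈ with ∈-map⁻ ∣_∣ m∈
  ... | Z , Z∈ , refl with ∈-map⁻ (_Δ X) Z∈
  ...   | Y′ , Y′∈MG , refl = nullity-≤-distance G X Y′ (Equivalence.to (∈-MG⇔ G Y′) Y′∈MG)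

-- Inserting a vertex

data PunchInView {n} (u : Fin (suc n)) : Fin (suc n) → Set where
  is-u       : PunchInView u u
  is-punchIn : ∀ i → PunchInView u (punchIn u i)

punchInView : ∀ {n} (u j : Fin (suc n)) → PunchInView u j
punchInView u j with j ≟ u
... | yes refl = is-u
... | no  j≢u  = subst (PunchInView u) (punchIn-punchOut (j≢u ∘ sym)) (is-punchIn (punchOut (j≢u ∘ sym)))

module _ {n} (G : Matrix (suc n)) (u : Fin (suc n)) where

  InKernel-insertAt : ∀ X x b t → InKernel G (insertAt X u b) (insertAt x u t) ⇔
    ((t ≡ true → b ≡ true) × x ⊑ X × (b ≡ true → G u · insertAt x u t ≡ false) ×
     (∀ i → lookup X i ≡ true → G (punchIn u i) · insertAt x u t ≡ false))
  InKernel-insertAt X x b t = mk⇔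
    (λ (sup , rows) →
        (λ t≡true → trans (sym (insertAt-lookup X u b)) (sup u (trans (insertAt-lookup x u t) t≡true)))
      , (λ j xj → trans (sym (insertAt-punchIn X u b j)) (sup (punchIn u j) (trans (insertAt-punchIn x u t j) xj)))
      , (λ b≡true → rows u (trans (insertAt-lookup X u b) b≡true))
      , (λ i Xi → rows (punchIn u i) (trans (insertAt-punchIn X u b i) Xi)))
    (λ (t⇒b , x⊑X , row-u , rows) → sup t⇒b x⊑X , row t⇒b row-u rows)
    where
    sup : (t ≡ true → b ≡ true) → x ⊑ X → insertAt x u t ⊑ insertAt X u b
    sup t⇒b x⊑X j with punchInView u j
    ... | is-u = λ h → trans (insertAt-lookup X u b) (t⇒b (trans (sym (insertAt-lookup x u t)) h))
    ... | is-punchIn i = λ h → trans (insertAt-punchIn X u b i) (x⊑X i (trans (sym (insertAt-punchIn x u t i)) h))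
    row : (t ≡ true → b ≡ true) → (b ≡ true → G u · insertAt x u t ≡ false) →
          (∀ i → lookup X i ≡ true → G (punchIn u i) · insertAt x u t ≡ false) →
          ∀ j → lookup (insertAt X u b) j ≡ true → G j · insertAt x u t ≡ false
    row _ row-u rows j with punchInView u j
    ... | is-u = λ h → row-u (trans (sym (insertAt-lookup X u b)) h)
    ... | is-punchIn i = λ h → rows i (trans (sym (insertAt-punchIn X u b i)) h)

  kernelSize-insertAt-graph : ∀ (H : Matrix n) X Z b (f : Subset n → Bool) (φ : Subset n → Subset n) →
    (∀ t x → InKernel G (insertAt X u b) (insertAt x u t) ⇔ (t ≡ f x × InKernel H Z (φ x))) →
    kernelSize G (insertAt X u b) ≡ count n (λ x → inKernel H Z (φ x))
  kernelSize-insertAt-graph H X Z b f φ G⇔ = trans (kernelSize≡count G (insertAt X u b))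
    (count-insertAt-graph n u (inKernel G (insertAt X u b)) f (λ x → inKernel H Z (φ x)) λ t x →
      ((⇔-id _ ×-⇔ ⇔-sym (inKernel⇔ H Z (φ x))) ⇔-∘ G⇔ t x) ⇔-∘ inKernel⇔ G (insertAt X u b) (insertAt x u t))

  ·-insertAt-false : ∀ i x → G (punchIn u i) · insertAt x u false ≡ del G u i · x
  ·-insertAt-false i x =
    trans (·-insertAt (G (punchIn u i)) x u false) (cong (_xor del G u i · x) (∧-zeroʳ (G (punchIn u i) u)))

  InKernel-outside : ∀ X x t →
    InKernel G (insertAt X u false) (insertAt x u t) ⇔ (t ≡ false × InKernel (del G u) X x)
  InKernel-outside X x t = mk⇔
    (λ h → let (t⇒false , x⊑X , _ , rows) = to (InKernel-insertAt X x false t) h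
               t≡false = ¬-not (λ t≡true → true≢false (sym (t⇒false t≡true)))
               rows′ = subst (λ s → ∀ i → lookup X i ≡ true → G (punchIn u i) · insertAt x u s ≡ false) t≡false rows
           in t≡false , x⊑X , λ i Xi → trans (sym (·-insertAt-false i x)) (rows′ i Xi))
    (λ { (refl , x⊑X , rows) → from (InKernel-insertAt X x false false)
           ((λ ()) , x⊑X , (λ ()) , λ i Xi → trans (·-insertAt-false i x) (rows i Xi)) })
    where open Equivalence

  kernelSize-outside : ∀ X → kernelSize G (insertAt X u false) ≡ kernelSize (del G u) X
  kernelSize-outside X =
    trans (kernelSize-insertAt-graph (del G u) X X false (λ _ → false) (λ x → x) (λ t x → InKernel-outside X x t))
          (sym (kernelSize≡count (del G u) X))

  InKernel-isolated : Symmetric G → (∀ w → G u w ≡ false) → ∀ X x t →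
                      InKernel G (insertAt X u true) (insertAt x u t) ⇔ InKernel (del G u) X x
  InKernel-isolated G-sym isolated X x t = mk⇔
    (λ h → let (_ , x⊑X , _ , rows) = to (InKernel-insertAt X x true t) h in
           x⊑X , λ i Xi → trans (sym (row i)) (rows i Xi))
    (λ (x⊑X , rows) → from (InKernel-insertAt X x true t)
           ((λ _ → refl) , x⊑X , (λ _ → ·-zeroˡ isolated (insertAt x u t)) , λ i Xi → trans (row i) (rows i Xi)))
    where
    open Equivalence
    row : ∀ i → G (punchIn u i) · insertAt x u t ≡ del G u i · x
    row i = trans (·-insertAt (G (punchIn u i)) x u t)
                  (cong (λ b → (b ∧ t) xor del G u i · x) (trans (G-sym _ u) (isolated _)))

  kernelSize-isolated : Symmetric G → (∀ w → G u w ≡ false) → ∀ X →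
                        kernelSize G (insertAt X u true) ≡ kernelSize (del G u) X + kernelSize (del G u) X
  kernelSize-isolated G-sym isolated X = begin
    kernelSize G (insertAt X u true)
      ≡⟨ kernelSize≡count G (insertAt X u true) ⟩
    count (suc n) (inKernel G (insertAt X u true))
      ≡⟨ count-insertAt-constant n u (inKernel G (insertAt X u true)) (inKernel (del G u) X) same ⟩
    count n (inKernel (del G u) X) + count n (inKernel (del G u) X)
      ≡⟨ cong₂ _+_ (kernelSize≡count (del G u) X) (kernelSize≡count (del G u) X) ⟨
    kernelSize (del G u) X + kernelSize (del G u) X ∎
    where
    open ≡-Reasoning
    same : ∀ t x → inKernel G (insertAt X u true) (insertAt x u t) ≡ inKernel (del G u) X x
    same t x = inKernel-cong G (insertAt X u true) (insertAt x u t) (del G u) X x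
                             (InKernel-isolated G-sym isolated X x t)

  localComp-punchIn : ∀ i j → localComp G u (punchIn u i) (punchIn u j) ≡
                              G (punchIn u i) (punchIn u j) xor (G u (punchIn u i) ∧ G u (punchIn u j))
  localComp-punchIn i j rewrite ==-≢ (punchInᵢ≢i u i) | ==-≢ (punchInᵢ≢i u j) = refl

  ·-localComp : ∀ i x →
    del (localComp G u) u i · x ≡ del G u i · x xor (G u (punchIn u i) ∧ (G u ∘ punchIn u) · x)
  ·-localComp i x = trans (·-congˡ (localComp-punchIn i) x)
    (trans (·-xorˡ (del G u i) (λ j → G u (punchIn u i) ∧ G u (punchIn u j)) x)
           (cong (del G u i · x xor_) (·-∧ˡ (G u (punchIn u i)) (G u ∘ punchIn u) x)))

  InKernel-looped : Symmetric G → G u u ≡ true → ∀ X x t →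
    InKernel G (insertAt X u true) (insertAt x u t) ⇔
    (t ≡ (G u ∘ punchIn u) · x × InKernel (del (localComp G u) u) X x)
  InKernel-looped G-sym uu X x t = mk⇔
    (λ h → let (_ , x⊑X , row-u≡0 , rows) = to (InKernel-insertAt X x true t) h
               t≡β = xor-≡-false (trans (sym row-u) (row-u≡0 refl))
           in t≡β , x⊑X , λ i Xi → trans (sym (row i t≡β)) (rows i Xi))
    (λ (t≡β , x⊑X , rows) → from (InKernel-insertAt X x true t)
       ( (λ _ → refl) , x⊑X
       , (λ _ → trans row-u (trans (cong (_xor β) t≡β) (xor-same β)))
       , λ i Xi → trans (row i t≡β) (rows i Xi)))
    where
    open Equivalence
    β = (G u ∘ punchIn u) · x
    row-u : G u · insertAt x u t ≡ t xor β
    row-u = trans (·-insertAt (G u) x u t) (cong (λ b → (b ∧ t) xor β) uu)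
    row : ∀ i → t ≡ β → G (punchIn u i) · insertAt x u t ≡ del (localComp G u) u i · x
    row i t≡β = begin
      G (punchIn u i) · insertAt x u t                 ≡⟨ ·-insertAt (G (punchIn u i)) x u t ⟩
      (G (punchIn u i) u ∧ t) xor del G u i · x        ≡⟨ cong₂ (λ a b → (a ∧ b) xor γ) (G-sym _ u) t≡β ⟩
      (G u (punchIn u i) ∧ β) xor del G u i · x        ≡⟨ xor-comm (G u (punchIn u i) ∧ β) (del G u i · x) ⟩
      del G u i · x xor (G u (punchIn u i) ∧ β)        ≡⟨ ·-localComp i x ⟨
      del (localComp G u) u i · x                      ∎
      where
      open ≡-Reasoning
      γ = del G u i · x

  kernelSize-looped : Symmetric G → G u u ≡ true → ∀ X →
                      kernelSize G (insertAt X u true) ≡ kernelSize (del (localComp G u) u) X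
  kernelSize-looped G-sym uu X =
    trans (kernelSize-insertAt-graph _ X X true (G u ∘ punchIn u ·_) (λ x → x)
                                     (λ t x → InKernel-looped G-sym uu X x t))
          (sym (kernelSize≡count _ X))

-- Edge pivots

punchIn-== : ∀ {n} (u : Fin (suc n)) i j → (punchIn u i == punchIn u j) ≡ (i == j)
punchIn-== u i j with i ≟ j
... | yes refl = ==-refl (punchIn u i)
... | no  i≢j  = ==-≢ (i≢j ∘ punchIn-injective u i j)

·-== : ∀ {n} (w : Fin n) y → (_== w) · y ≡ lookup y w
·-== w y = begin
  (_== w) · y
    ≡⟨ ·-[]≔false (_== w) y w ⟩
  (_== w) · (y [ w ]≔ false) xor ((w == w) ∧ lookup y w)
    ≡⟨ cong₂ (λ a b → a xor (b ∧ lookup y w)) off-w (==-refl w) ⟩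
  lookup y w ∎
  where
  open ≡-Reasoning
  off-w : (_== w) · (y [ w ]≔ false) ≡ false
  off-w = ·-zero-on-support (_== w) (y [ w ]≔ false) λ j yj → ==-≢ λ { refl →
            true≢false (trans (sym yj) (lookup∘update j y false)) }

module _ {n} (G : Matrix (suc n)) (G-sym : Symmetric G) (u : Fin (suc n)) (v′ : Fin n)
         (uv : G u (punchIn u v′) ≡ true) (uu : G u u ≡ false) (vv : G (punchIn u v′) (punchIn u v′) ≡ false)
         where

  private
    v : Fin (suc n)
    v = punchIn u v′
    H : Matrix n
    H = del (edgeComp G u v) u
    α β : Subset n → Bool
    α x = (G u ∘ punchIn u) · x
    β x = (G v ∘ punchIn u) · x

  H-row-v′ : ∀ j → H v′ j ≡ G u (punchIn u j) xor (j == v′)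
  H-row-v′ j with j ≟ v′
  ... | yes refl rewrite ==-refl v | ==-≢ (punchInᵢ≢i u v′) = trans vv (sym (cong (_xor true) uv))
  ... | no  j≢v′ rewrite ==-refl v | ==-≢ (punchInᵢ≢i u v′) | ==-≢ (punchInᵢ≢i u j)
                       | punchIn-== u j v′ | ==-≢ j≢v′ = sym (xor-identityʳ _)

  H-row : ∀ i → i ≢ v′ → ∀ j → H i j ≡
    ((G (punchIn u i) (punchIn u j) xor (G (punchIn u i) u ∧ G v (punchIn u j))) xor
     (G (punchIn u i) v ∧ G u (punchIn u j))) xor (G (punchIn u i) u ∧ (j == v′))
  H-row i i≢v′ j with j ≟ v′
  ... | yes refl rewrite ==-≢ (punchInᵢ≢i u i) | punchIn-== u i v′ | ==-≢ i≢v′ | ==-refl v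
                       | ==-≢ (punchInᵢ≢i u v′) | vv | uv =
    solve 2 (λ a g → a := ((g :+ (a :* con false)) :+ (g :* con true)) :+ (a :* con true))
            refl (G (punchIn u i) u) (G (punchIn u i) v)
    where open xor-∧-Solver
  ... | no  j≢v′ rewrite ==-≢ (punchInᵢ≢i u i) | punchIn-== u i v′ | ==-≢ i≢v′ | ==-≢ (punchInᵢ≢i u j)
                       | punchIn-== u j v′ | ==-≢ j≢v′ =
    solve 5 (λ g a b c d → g :+ ((a :* b) :+ (c :* d)) := ((g :+ (a :* b)) :+ (c :* d)) :+ (a :* con false))
            refl (G (punchIn u i) (punchIn u j)) (G (punchIn u i) u) (G v (punchIn u j)) (G (punchIn u i) v)
                 (G u (punchIn u j))
    where open xor-∧-Solver

  ·-H-v′ : ∀ y → H v′ · y ≡ α y xor lookup y v′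
  ·-H-v′ y = trans (·-congˡ H-row-v′ y)
    (trans (·-xorˡ (G u ∘ punchIn u) (_== v′) y) (cong (α y xor_) (·-== v′ y)))

  ·-H : ∀ i → i ≢ v′ → ∀ y → H i · y ≡
        ((del G u i · y xor (G (punchIn u i) u ∧ β y)) xor (G (punchIn u i) v ∧ α y)) xor
        (G (punchIn u i) u ∧ lookup y v′)
  ·-H i i≢v′ y = begin
    H i · y
      ≡⟨ ·-congˡ (H-row i i≢v′) y ⟩
    (λ j → ((g j xor (a ∧ G v (p j))) xor (c ∧ G u (p j))) xor (a ∧ (j == v′))) · y
      ≡⟨ ·-xorˡ (λ j → (g j xor (a ∧ G v (p j))) xor (c ∧ G u (p j))) (λ j → a ∧ (j == v′)) y ⟩
    (λ j → (g j xor (a ∧ G v (p j))) xor (c ∧ G u (p j))) · y xor (λ j → a ∧ (j == v′)) · y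
      ≡⟨ cong₂ _xor_ (·-xorˡ (λ j → g j xor (a ∧ G v (p j))) (λ j → c ∧ G u (p j)) y)
                     (trans (·-∧ˡ a (_== v′) y) (cong (a ∧_) (·-== v′ y))) ⟩
    ((λ j → g j xor (a ∧ G v (p j))) · y xor (λ j → c ∧ G u (p j)) · y) xor (a ∧ lookup y v′)
      ≡⟨ cong (λ b → (b xor (λ j → c ∧ G u (p j)) · y) xor (a ∧ lookup y v′))
              (trans (·-xorˡ g (λ j → a ∧ G v (p j)) y) (cong (g · y xor_) (·-∧ˡ a (G v ∘ p) y))) ⟩
    ((g · y xor (a ∧ β y)) xor (λ j → c ∧ G u (p j)) · y) xor (a ∧ lookup y v′)
      ≡⟨ cong (λ b → ((g · y xor (a ∧ β y)) xor b) xor (a ∧ lookup y v′)) (·-∧ˡ c (G u ∘ p) y) ⟩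
    ((g · y xor (a ∧ β y)) xor (c ∧ α y)) xor (a ∧ lookup y v′) ∎
    where
    open ≡-Reasoning
    p = punchIn u
    g = del G u i
    a = G (punchIn u i) u
    c = G (punchIn u i) v

  α-[]≔ : ∀ x s → α (x [ v′ ]≔ s) ≡ α x xor (lookup x v′ xor s)
  α-[]≔ x s = trans (·-[]≔ (G u ∘ punchIn u) x v′ s) (cong (λ b → α x xor (b ∧ (lookup x v′ xor s))) uv)

  β-[]≔ : ∀ x s → β (x [ v′ ]≔ s) ≡ β x
  β-[]≔ x s = trans (·-[]≔ (G v ∘ punchIn u) x v′ s)
                    (trans (cong (λ b → β x xor (b ∧ (lookup x v′ xor s))) vv) (xor-identityʳ (β x)))

  ·-H-[]≔ : ∀ i → i ≢ v′ → ∀ x s → H i · (x [ v′ ]≔ s) ≡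
            ((del G u i · x xor (G (punchIn u i) u ∧ β x)) xor (G (punchIn u i) v ∧ α x)) xor
            (G (punchIn u i) u ∧ s)
  ·-H-[]≔ i i≢v′ x s = begin
    H i · (x [ v′ ]≔ s)
      ≡⟨ ·-H i i≢v′ (x [ v′ ]≔ s) ⟩
    ((γ y xor (a ∧ β y)) xor (c ∧ α y)) xor (a ∧ lookup y v′)
      ≡⟨ cong₂ (λ b d → ((γ y xor (a ∧ b)) xor (c ∧ α y)) xor (a ∧ d)) (β-[]≔ x s) (lookup∘update v′ x s) ⟩
    ((γ y xor (a ∧ β x)) xor (c ∧ α y)) xor (a ∧ s)
      ≡⟨ cong₂ (λ b d → ((b xor (a ∧ β x)) xor (c ∧ d)) xor (a ∧ s)) (·-[]≔ (del G u i) x v′ s) (α-[]≔ x s) ⟩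
    (((γ x xor (c ∧ e)) xor (a ∧ β x)) xor (c ∧ (α x xor e))) xor (a ∧ s)
      ≡⟨ solve 7 (λ γx c e a βx αx s → (((γx :+ (c :* e)) :+ (a :* βx)) :+ (c :* (αx :+ e))) :+ (a :* s)
                                      := ((γx :+ (a :* βx)) :+ (c :* αx)) :+ (a :* s))
               refl (γ x) c e a (β x) (α x) s ⟩
    ((γ x xor (a ∧ β x)) xor (c ∧ α x)) xor (a ∧ s) ∎
    where
    open ≡-Reasoning
    open xor-∧-Solver
    y = x [ v′ ]≔ s
    γ = del G u i ·_
    a = G (punchIn u i) u
    c = G (punchIn u i) v
    e = lookup x v′ xor s

  ·-H-v′-[]≔ : ∀ x s → H v′ · (x [ v′ ]≔ s) ≡ α x xor lookup x v′
  ·-H-v′-[]≔ x s = trans (·-H-v′ (x [ v′ ]≔ s))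
    (trans (cong₂ _xor_ (α-[]≔ x s) (lookup∘update v′ x s))
           (solve 3 (λ a b s → (a :+ (b :+ s)) :+ s := a :+ b) refl (α x) (lookup x v′) s))
    where open xor-∧-Solver

  G-row-u : ∀ x t → G u · insertAt x u t ≡ α x
  G-row-u x t = trans (·-insertAt (G u) x u t) (cong (λ b → (b ∧ t) xor α x) uu)

  G-row-v : ∀ x t → G v · insertAt x u t ≡ t xor β x
  G-row-v x t = trans (·-insertAt (G v) x u t) (cong (λ b → (b ∧ t) xor β x) (trans (G-sym v u) uv))

  G-row≡H-row : ∀ i → i ≢ v′ → ∀ x t s → α x ≡ false → t xor β x ≡ s →
                G (punchIn u i) · insertAt x u t ≡ H i · (x [ v′ ]≔ s)
  G-row≡H-row i i≢v′ x t s αx≡false refl = begin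
    G (punchIn u i) · insertAt x u t
      ≡⟨ ·-insertAt (G (punchIn u i)) x u t ⟩
    (a ∧ t) xor γ
      ≡⟨ solve 5 (λ a t γ β c → (a :* t) :+ γ := ((γ :+ (a :* β)) :+ (c :* con false)) :+ (a :* (t :+ β)))
                 refl a t γ (β x) c ⟩
    ((γ xor (a ∧ β x)) xor (c ∧ false)) xor (a ∧ (t xor β x))
      ≡⟨ cong (λ b → ((γ xor (a ∧ β x)) xor (c ∧ b)) xor (a ∧ (t xor β x))) αx≡false ⟨
    ((γ xor (a ∧ β x)) xor (c ∧ α x)) xor (a ∧ (t xor β x))
      ≡⟨ ·-H-[]≔ i i≢v′ x (t xor β x) ⟨
    H i · (x [ v′ ]≔ (t xor β x)) ∎
    where
    open ≡-Reasoning
    open xor-∧-Solver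
    γ = del G u i · x
    a = G (punchIn u i) u
    c = G (punchIn u i) v

  private
    case-v′ : ∀ {A : Set} j → (j ≡ v′ → A) → (j ≢ v′ → A) → A
    case-v′ j same other = [ same , other ]′ (Dec.toSum (j ≟ v′))

  -- A kernel vector (t, x) of G[X ∪ u] has α x ≡ false; setting coordinate v′ to α x rather than
  -- to false gives the same H-kernel vector but is a shear of all of Subset n (see ∑-shear).
  InKernel-edge-∈ : ∀ X → lookup X v′ ≡ true → ∀ x t →
    InKernel G (insertAt X u true) (insertAt x u t) ⇔ (t ≡ β x × InKernel H (X [ v′ ]≔ false) (x [ v′ ]≔ α x))
  InKernel-edge-∈ X Xv′ x t = mk⇔
    (λ h → let (_ , x⊑X , row-u≡0 , rows) = to (InKernel-insertAt G u X x true t) h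
               αx≡false = trans (sym (G-row-u x t)) (row-u≡0 refl)
               t⊕βx≡false = trans (sym (G-row-v x t)) (rows v′ Xv′)
               t⊕βx≡αx = trans t⊕βx≡false (sym αx≡false)
           in xor-≡-false t⊕βx≡false
            , []≔-⊑ x X v′ (λ αx≡true → ⊥-elim (true≢false (trans (sym αx≡true) αx≡false))) x⊑X
            , (λ i Zi → case-v′ i (λ { refl → ⊥-elim (true≢false (trans (sym Zi) (lookup∘update i X false))) })
                 (λ i≢v′ → trans (sym (G-row≡H-row i i≢v′ x t (α x) αx≡false t⊕βx≡αx))
                                 (rows i (lookup-[]≔⁻ X false i≢v′ Zi)))))
    (λ (t≡βx , y⊑Z , H-rows) →
       let αx≡false = ¬-not λ αx≡true → true≢false
                        (trans (sym (y⊑Z v′ (trans (lookup∘update v′ x (α x)) αx≡true))) (lookup∘update v′ X false))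
           t⊕βx≡αx = trans (cong (_xor β x) t≡βx) (trans (xor-same (β x)) (sym αx≡false))
       in from (InKernel-insertAt G u X x true t)
          ( (λ _ → refl)
          , ⊑-[]≔⁻ x X v′ y⊑Z (λ _ → Xv′)
          , (λ _ → trans (G-row-u x t) αx≡false)
          , (λ i Xi → case-v′ i (λ { refl → trans (G-row-v x t) (trans t⊕βx≡αx αx≡false) })
               (λ i≢v′ → trans (G-row≡H-row i i≢v′ x t (α x) αx≡false t⊕βx≡αx)
                               (H-rows i (lookup-[]≔⁺ X false i≢v′ Xi))))))
    where open Equivalence

  InKernel-edge-∉ : ∀ X → lookup X v′ ≡ false → ∀ x t →
    InKernel G (insertAt X u true) (insertAt x u t) ⇔
    (lookup x v′ ≡ false × InKernel H (X [ v′ ]≔ true) (x [ v′ ]≔ (t xor β x)))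
  InKernel-edge-∉ X Xv′ x t = mk⇔
    (λ h → let (_ , x⊑X , row-u≡0 , rows) = to (InKernel-insertAt G u X x true t) h
               xv′≡false = ¬-not λ xv′≡true → true≢false (trans (sym (x⊑X v′ xv′≡true)) Xv′)
               αx≡false = trans (sym (G-row-u x t)) (row-u≡0 refl)
           in xv′≡false
            , []≔-⊑ x X v′ (λ _ → refl) x⊑X
            , (λ i Zi → case-v′ i
                 (λ { refl → trans (·-H-v′-[]≔ x (t xor β x)) (cong₂ _xor_ αx≡false xv′≡false) })
                 (λ i≢v′ → trans (sym (G-row≡H-row i i≢v′ x t (t xor β x) αx≡false refl))
                                 (rows i (lookup-[]≔⁻ X true i≢v′ Zi)))))
    (λ (xv′≡false , y⊑Z , H-rows) →
       let αx≡false = trans (sym (xor-identityʳ (α x)))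
                        (trans (cong (α x xor_) (sym xv′≡false))
                               (trans (sym (·-H-v′-[]≔ x (t xor β x))) (H-rows v′ (lookup∘update v′ X true))))
       in from (InKernel-insertAt G u X x true t)
          ( (λ _ → refl)
          , ⊑-[]≔⁻ x X v′ y⊑Z (λ xv′≡true → ⊥-elim (true≢false (trans (sym xv′≡true) xv′≡false)))
          , (λ _ → trans (G-row-u x t) αx≡false)
          , (λ i Xi → case-v′ i (λ { refl → ⊥-elim (true≢false (trans (sym Xi) Xv′)) })
               (λ i≢v′ → trans (G-row≡H-row i i≢v′ x t (t xor β x) αx≡false refl)
                               (H-rows i (lookup-[]≔⁺ X true i≢v′ Xi))))))
    where open Equivalence

  kernelSize-edge : ∀ X → kernelSize G (insertAt X u true) ≡ kernelSize H (X Δ ⁅ v′ ⁆)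
  kernelSize-edge X with lookup X v′ in Xv′
  ... | true = begin
    kernelSize G (insertAt X u true)
      ≡⟨ kernelSize-insertAt-graph G u H X Z true β (λ x → x [ v′ ]≔ α x) (λ t x → InKernel-edge-∈ X Xv′ x t) ⟩
    count n (λ x → inKernel H Z (x [ v′ ]≔ α x))
      ≡⟨ count-cong n (λ x → cong (λ b → inKernel H Z (x [ v′ ]≔ b)) (α-split x)) ⟩
    count n (λ x → inKernel H Z (x [ v′ ]≔ (lookup x v′ xor α (x [ v′ ]≔ false))))
      ≡⟨ count-shear n v′ α (inKernel H Z) ⟩
    count n (inKernel H Z)
      ≡⟨ kernelSize≡count H Z ⟨
    kernelSize H Z
      ≡⟨ cong (λ b → kernelSize H (X [ v′ ]≔ not b)) Xv′ ⟨
    kernelSize H (X [ v′ ]≔ not (lookup X v′))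
      ≡⟨ cong (kernelSize H) (Δ-⁅⁆ X v′) ⟨
    kernelSize H (X Δ ⁅ v′ ⁆) ∎
    where
    open ≡-Reasoning
    Z = X [ v′ ]≔ false
    α-split : ∀ x → α x ≡ lookup x v′ xor α (x [ v′ ]≔ false)
    α-split x = sym (trans (cong (lookup x v′ xor_) (α-[]≔ x false))
      (solve 2 (λ a b → b :+ (a :+ (b :+ con false)) := a) refl (α x) (lookup x v′)))
      where open xor-∧-Solver
  ... | false = begin
    kernelSize G (insertAt X u true)
      ≡⟨ kernelSize≡count G (insertAt X u true) ⟩
    count (suc n) (inKernel G (insertAt X u true))
      ≡⟨ count-move-coordinate n u v′ (inKernel G (insertAt X u true)) β (inKernel H Z) β-[]≔ as-bool ⟩
    count n (inKernel H Z)
      ≡⟨ kernelSize≡count H Z ⟨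
    kernelSize H Z
      ≡⟨ cong (λ b → kernelSize H (X [ v′ ]≔ not b)) Xv′ ⟨
    kernelSize H (X [ v′ ]≔ not (lookup X v′))
      ≡⟨ cong (kernelSize H) (Δ-⁅⁆ X v′) ⟨
    kernelSize H (X Δ ⁅ v′ ⁆) ∎
    where
    open ≡-Reasoning
    open Equivalence
    Z = X [ v′ ]≔ true
    as-bool : ∀ t x → inKernel G (insertAt X u true) (insertAt x u t) ≡
                      not (lookup x v′) ∧ inKernel H Z (x [ v′ ]≔ (t xor β x))
    as-bool t x = ≡-by-truth
      (λ h → let (xv′≡false , y∈K) = to (edge⇔ t x) (to (G⇔ t x) h) in
             cong₂ _∧_ (cong not xv′≡false) (from (H⇔ t x) y∈K))
      (λ h → let (¬xv′ , y∈K) = ∧-≡-true h in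
             from (G⇔ t x) (from (edge⇔ t x) (not-≡-true ¬xv′ , to (H⇔ t x) y∈K)))
      where
      G⇔ : ∀ t x → _
      G⇔ t x = inKernel⇔ G (insertAt X u true) (insertAt x u t)
      H⇔ : ∀ t x → _
      H⇔ t x = inKernel⇔ H Z (x [ v′ ]≔ (t xor β x))
      edge⇔ = λ t x → InKernel-edge-∉ X Xv′ x t

-- The recursion for the nullity polynomial

sign-suc : ∀ k → sign (suc k) ≡ - sign k
sign-suc k = ℤ.-1*i≡-i (sign k)

sign-Δ⁅⁆ : ∀ {n} (X : Subset n) w → sign (suc ∣ X ∣) ≡ sign ∣ X Δ ⁅ w ⁆ ∣
sign-Δ⁅⁆ X w = begin
  sign (suc ∣ X ∣)                          ≡⟨ cong (sign ∘ suc) (∣[]≔false∣ X w) ⟩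
  sign (suc (bit (lookup X w) + c))         ≡⟨ parity (lookup X w) ⟩
  sign (bit (not (lookup X w)) + c)         ≡⟨ cong (λ b → sign (bit b + c)) (lookup∘update w X _) ⟨
  sign (bit (lookup X′ w) + c)              ≡⟨ cong (λ Y → sign (bit (lookup X′ w) + ∣ Y ∣)) ([]≔-idempotent X w) ⟨
  sign (bit (lookup X′ w) + ∣ X′ [ w ]≔ false ∣) ≡⟨ cong sign (∣[]≔false∣ X′ w) ⟨
  sign ∣ X′ ∣                               ≡⟨ cong (sign ∘ ∣_∣) (Δ-⁅⁆ X w) ⟨
  sign ∣ X Δ ⁅ w ⁆ ∣                        ∎
  where
  open ≡-Reasoning
  c = ∣ X [ w ]≔ false ∣
  X′ = X [ w ]≔ not (lookup X w)
  parity : ∀ b → sign (suc (bit b + c)) ≡ sign (bit (not b) + c)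
  parity false = refl
  parity true  = trans (sign-suc (suc c)) (trans (cong -_ (sign-suc c)) (ℤ.neg-involutive (sign c)))

nullityTerm : ∀ {n} → Matrix n → ℤ → Subset n → ℤ
nullityTerm G y X = sign ∣ X ∣ ℤ.* (y ^ nullity G X)

nullityPoly≡∑ : ∀ {n} (G : Matrix n) y → nullityPoly G y ≡ ℤSum.∑ n (nullityTerm G y)
nullityPoly≡∑ {n} G y = ℤSum.∑≈foldr n (nullityTerm G y)

nullityPoly-insertAt : ∀ {n} (G : Matrix (suc n)) u y →
  nullityPoly G y ≡ ℤSum.∑ n (λ X → nullityTerm G y (insertAt X u true)) ℤ.+ nullityPoly (del G u) y
nullityPoly-insertAt {n} G u y = begin
  nullityPoly G y
    ≡⟨ nullityPoly≡∑ G y ⟩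
  ℤSum.∑ (suc n) (nullityTerm G y)
    ≡⟨ ℤSum.∑-insertAt n u (nullityTerm G y) ⟩
  ℤSum.∑ n (λ X → nullityTerm G y (insertAt X u true)) ℤ.+ ℤSum.∑ n (λ X → nullityTerm G y (insertAt X u false))
    ≡⟨ cong (ℤ._+_ (ℤSum.∑ n (λ X → nullityTerm G y (insertAt X u true))))
            (trans (ℤSum.∑-cong n outside) (sym (nullityPoly≡∑ (del G u) y))) ⟩
  ℤSum.∑ n (λ X → nullityTerm G y (insertAt X u true)) ℤ.+ nullityPoly (del G u) y ∎
  where
  open ≡-Reasoning
  outside : ∀ X → nullityTerm G y (insertAt X u false) ≡ nullityTerm (del G u) y X
  outside X = cong₂ (λ k m → sign k ℤ.* (y ^ m)) (∣insertAt∣ X u false) (cong ⌊log₂_⌋ (kernelSize-outside G u X))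

∑-scale : ∀ n c (f : Subset n → ℤ) → ℤSum.∑ n (λ X → c ℤ.* f X) ≡ c ℤ.* ℤSum.∑ n f
∑-scale n c = ℤSum.∑-hom n (c ℤ.*_) (cong (c ℤ.*_)) (ℤ.*-distribˡ-+ c)

module _ {n} (G : Matrix (suc n)) (G-sym : Symmetric G) (u : Fin (suc n)) (y : ℤ) where

  nullityPoly-looped : G u u ≡ true →
    nullityPoly G y ≡ nullityPoly (del G u) y - nullityPoly (del (localComp G u) u) y
  nullityPoly-looped uu = begin
    nullityPoly G y
      ≡⟨ nullityPoly-insertAt G u y ⟩
    ℤSum.∑ n (λ X → nullityTerm G y (insertAt X u true)) ℤ.+ nullityPoly (del G u) y
      ≡⟨ cong (ℤ._+ nullityPoly (del G u) y) (trans (ℤSum.∑-cong n inside) (∑-scale n (- ℤ.+ 1) (nullityTerm L y))) ⟩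
    (- ℤ.+ 1) ℤ.* ℤSum.∑ n (nullityTerm L y) ℤ.+ nullityPoly (del G u) y
      ≡⟨ cong (λ P → (- ℤ.+ 1) ℤ.* P ℤ.+ nullityPoly (del G u) y) (nullityPoly≡∑ L y) ⟨
    (- ℤ.+ 1) ℤ.* nullityPoly L y ℤ.+ nullityPoly (del G u) y
      ≡⟨ rearrange (nullityPoly L y) (nullityPoly (del G u) y) ⟩
    nullityPoly (del G u) y - nullityPoly L y ∎
    where
    open ≡-Reasoning
    L = del (localComp G u) u
    rearrange : ∀ a b → (- ℤ.+ 1) ℤ.* a ℤ.+ b ≡ b - a
    rearrange = solve-∀
    inside : ∀ X → nullityTerm G y (insertAt X u true) ≡ (- ℤ.+ 1) ℤ.* nullityTerm L y X
    inside X = trans (cong₂ (λ k m → sign k ℤ.* (y ^ m)) (∣insertAt∣ X u true)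
                            (cong ⌊log₂_⌋ (kernelSize-looped G u G-sym uu X)))
                     (ℤ.*-assoc (- ℤ.+ 1) (sign ∣ X ∣) _)

  nullityPoly-isolated : (∀ w → G u w ≡ false) → nullityPoly G y ≡ (ℤ.+ 1 - y) ℤ.* nullityPoly (del G u) y
  nullityPoly-isolated isolated = begin
    nullityPoly G y
      ≡⟨ nullityPoly-insertAt G u y ⟩
    ℤSum.∑ n (λ X → nullityTerm G y (insertAt X u true)) ℤ.+ nullityPoly (del G u) y
      ≡⟨ cong (ℤ._+ nullityPoly (del G u) y) (trans (ℤSum.∑-cong n inside) (∑-scale n (- y) (nullityTerm (del G u) y))) ⟩
    (- y) ℤ.* ℤSum.∑ n (nullityTerm (del G u) y) ℤ.+ nullityPoly (del G u) y
      ≡⟨ cong (λ P → (- y) ℤ.* P ℤ.+ nullityPoly (del G u) y) (nullityPoly≡∑ (del G u) y) ⟨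
    (- y) ℤ.* nullityPoly (del G u) y ℤ.+ nullityPoly (del G u) y
      ≡⟨ factor y (nullityPoly (del G u) y) ⟩
    (ℤ.+ 1 - y) ℤ.* nullityPoly (del G u) y ∎
    where
    open ≡-Reasoning
    factor : ∀ y P → (- y) ℤ.* P ℤ.+ P ≡ (ℤ.+ 1 - y) ℤ.* P
    factor = solve-∀
    ν-inside : ∀ X → nullity G (insertAt X u true) ≡ suc (nullity (del G u) X)
    ν-inside X = trans (cong ⌊log₂_⌋ (kernelSize-isolated G u G-sym isolated X))
                       (⌊log₂[m+m]⌋ _ (kernelSize-pos (del G u) X))
    inside : ∀ X → nullityTerm G y (insertAt X u true) ≡ (- y) ℤ.* nullityTerm (del G u) y X
    inside X = trans (cong₂ (λ k m → sign k ℤ.* (y ^ m)) (∣insertAt∣ X u true) (ν-inside X))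
                     (rearrange y (sign ∣ X ∣) (y ^ nullity (del G u) X))
      where
      rearrange : ∀ y s p → ((- ℤ.+ 1) ℤ.* s) ℤ.* (y ℤ.* p) ≡ (- y) ℤ.* (s ℤ.* p)
      rearrange = solve-∀

  nullityPoly-edge : ∀ v → G u v ≡ true → G u u ≡ false → G v v ≡ false →
    nullityPoly G y ≡ nullityPoly (del G u) y ℤ.+ nullityPoly (del (edgeComp G u v) u) y
  nullityPoly-edge v uv uu vv with punchInView u v
  ... | is-u          = ⊥-elim (true≢false (trans (sym uv) uu))
  ... | is-punchIn v′ = begin
    nullityPoly G y
      ≡⟨ nullityPoly-insertAt G u y ⟩
    ℤSum.∑ n (λ X → nullityTerm G y (insertAt X u true)) ℤ.+ nullityPoly (del G u) y
      ≡⟨ cong (ℤ._+ nullityPoly (del G u) y) (trans (ℤSum.∑-cong n inside) (ℤSum.∑-Δ n ⁅ v′ ⁆ (nullityTerm H y))) ⟩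
    ℤSum.∑ n (nullityTerm H y) ℤ.+ nullityPoly (del G u) y
      ≡⟨ cong (ℤ._+ nullityPoly (del G u) y) (nullityPoly≡∑ H y) ⟨
    nullityPoly H y ℤ.+ nullityPoly (del G u) y
      ≡⟨ ℤ.+-comm (nullityPoly H y) _ ⟩
    nullityPoly (del G u) y ℤ.+ nullityPoly H y ∎
    where
    open ≡-Reasoning
    H = del (edgeComp G u (punchIn u v′)) u
    inside : ∀ X → nullityTerm G y (insertAt X u true) ≡ nullityTerm H y (X Δ ⁅ v′ ⁆)
    inside X = cong₂ (λ k m → k ℤ.* (y ^ m))
      (trans (cong sign (∣insertAt∣ X u true)) (sign-Δ⁅⁆ X v′))
      (cong ⌊log₂_⌋ (kernelSize-edge G G-sym u v′ uv uu vv X))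

localComp-symmetric : ∀ {n} (G : Matrix n) → Symmetric G → ∀ u → Symmetric (localComp G u)
localComp-symmetric G G-sym u v w with v == u | w == u
... | true  | true  = G-sym v w
... | true  | false = G-sym v w
... | false | true  = G-sym v w
... | false | false = cong₂ _xor_ (G-sym v w) (∧-comm (G u v) (G u w))

edgeComp-symmetric : ∀ {n} (G : Matrix n) → Symmetric G → ∀ u v → Symmetric (edgeComp G u v)
edgeComp-symmetric G G-sym u v x y with x == u | x == v | y == u | y == v
... | true  | _     | true  | _     = G-sym x y
... | true  | _     | false | true  = G-sym x y
... | true  | _     | false | false = G-sym v y
... | false | true  | true  | _     = G-sym x y
... | false | true  | false | true  = G-sym x y
... | false | true  | false | false = G-sym u y
... | false | false | true  | _     = G-sym x v
... | false | false | false | true  = G-sym x u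
... | false | false | false | false
  rewrite G-sym y x | G-sym y u | G-sym v x | G-sym y v | G-sym u x =
  solve 5 (λ g a b c d → g :+ ((a :* b) :+ (c :* d)) := g :+ ((d :* c) :+ (b :* a))) refl
          (G x y) (G x u) (G v y) (G x v) (G u y)
  where open xor-∧-Solver

-- The recursion and its uniqueness

p₁≡nullityPoly : ∀ {n} (G : Matrix n) → Symmetric G → ∀ y → p₁ G y ≡ nullityPoly G y
p₁≡nullityPoly {n} G G-sym y = cong (foldr ℤ._+_ (ℤ.+ 0))
  (map-cong (λ X → cong (λ k → sign ∣ X ∣ ℤ.* (y ^ k)) (dmin-twist-MG G G-sym X)) (allSubsets n))

Recursion-nullityPoly : Recursion nullityPoly
Recursion-nullityPoly =
    (λ G G-sym u uu y → nullityPoly-looped G G-sym u y uu)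
  , (λ G G-sym u v uv uu vv y → nullityPoly-edge G G-sym u y v uv uu vv)
  , (λ G G-sym u isolated y → nullityPoly-isolated G G-sym u y isolated)
  , (λ G y → refl)

module _ {n} {G : Matrix (suc n)} (G-sym : Symmetric G) (u : Fin (suc n)) where

  del-symmetric : Symmetric (del G u)
  del-symmetric i j = G-sym (punchIn u i) (punchIn u j)

  del-localComp-symmetric : Symmetric (del (localComp G u) u)
  del-localComp-symmetric i j = localComp-symmetric G G-sym u (punchIn u i) (punchIn u j)

  del-edgeComp-symmetric : ∀ v → Symmetric (del (edgeComp G u v) u)
  del-edgeComp-symmetric v i j = edgeComp-symmetric G G-sym u v (punchIn u i) (punchIn u j)

Recursion-transport : ∀ {f g : ∀ {n} → Matrix n → ℤ → ℤ} →
  (∀ {n} (G : Matrix n) → Symmetric G → ∀ y → f G y ≡ g G y) → Recursion f → Recursion g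
Recursion-transport {f} {g} f≡g (looped , edge , isolated , empty) =
    (λ G G-sym u uu y → begin
       g G y                                         ≡⟨ f≡g G G-sym y ⟨
       f G y                                         ≡⟨ looped G G-sym u uu y ⟩
       f (del G u) y - f (del (localComp G u) u) y   ≡⟨ cong₂ _-_ (f≡g _ (del-symmetric G-sym u) y)
                                                                  (f≡g _ (del-localComp-symmetric G-sym u) y) ⟩
       g (del G u) y - g (del (localComp G u) u) y   ∎)
  , (λ G G-sym u v uv uu vv y → begin
       g G y                                            ≡⟨ f≡g G G-sym y ⟨
       f G y                                            ≡⟨ edge G G-sym u v uv uu vv y ⟩
       f (del G u) y ℤ.+ f (del (edgeComp G u v) u) y   ≡⟨ cong₂ ℤ._+_ (f≡g _ (del-symmetric G-sym u) y)
                                                                       (f≡g _ (del-edgeComp-symmetric G-sym u v) y) ⟩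
       g (del G u) y ℤ.+ g (del (edgeComp G u v) u) y   ∎)
  , (λ G G-sym u iso y → begin
       g G y                           ≡⟨ f≡g G G-sym y ⟨
       f G y                           ≡⟨ isolated G G-sym u iso y ⟩
       (ℤ.+ 1 - y) ℤ.* f (del G u) y   ≡⟨ cong ((ℤ.+ 1 - y) ℤ.*_) (f≡g _ (del-symmetric G-sym u) y) ⟩
       (ℤ.+ 1 - y) ℤ.* g (del G u) y   ∎)
  , (λ G y → trans (sym (f≡g G (λ ()) y)) (empty G y))
  where open ≡-Reasoning

Recursion-unique : ∀ {f g : ∀ {n} → Matrix n → ℤ → ℤ} → Recursion f → Recursion g →
                   ∀ {n} (G : Matrix n) → Symmetric G → ∀ y → f G y ≡ g G y
Recursion-unique (_ , _ , _ , f-empty) (_ , _ , _ , g-empty) {zero} G _ y = trans (f-empty G y) (sym (g-empty G y))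
Recursion-unique {f} {g} Rf@(f-looped , f-edge , f-isolated , _) Rg@(g-looped , g-edge , g-isolated , _) {suc n} G G-sym y
  with any? (λ u → G u u Bool.≟ true) | any? (λ u → any? (λ v → G u v Bool.≟ true))
... | yes (u , uu) | _ = begin
  f G y                                        ≡⟨ f-looped G G-sym u uu y ⟩
  f (del G u) y - f (del (localComp G u) u) y  ≡⟨ cong₂ _-_ (IH (del-symmetric G-sym u)) (IH (del-localComp-symmetric G-sym u)) ⟩
  g (del G u) y - g (del (localComp G u) u) y  ≡⟨ g-looped G G-sym u uu y ⟨
  g G y                                        ∎
  where
  open ≡-Reasoning
  IH : ∀ {H : Matrix n} → Symmetric H → f H y ≡ g H y
  IH H-sym = Recursion-unique {f} {g} Rf Rg _ H-sym y
... | no no-loop | yes (u , v , uv) = begin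
  f G y                                            ≡⟨ f-edge G G-sym u v uv (unlooped u) (unlooped v) y ⟩
  f (del G u) y ℤ.+ f (del (edgeComp G u v) u) y   ≡⟨ cong₂ ℤ._+_ (IH (del-symmetric G-sym u))
                                                                  (IH (del-edgeComp-symmetric G-sym u v)) ⟩
  g (del G u) y ℤ.+ g (del (edgeComp G u v) u) y   ≡⟨ g-edge G G-sym u v uv (unlooped u) (unlooped v) y ⟨
  g G y                                            ∎
  where
  open ≡-Reasoning
  unlooped : ∀ w → G w w ≡ false
  unlooped w = ¬-not λ ww → no-loop (w , ww)
  IH : ∀ {H : Matrix n} → Symmetric H → f H y ≡ g H y
  IH H-sym = Recursion-unique {f} {g} Rf Rg _ H-sym y
... | no _ | no no-edge = begin
  f G y                              ≡⟨ f-isolated G G-sym zero isolated y ⟩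
  (ℤ.+ 1 - y) ℤ.* f (del G zero) y   ≡⟨ cong ((ℤ.+ 1 - y) ℤ.*_) IH ⟩
  (ℤ.+ 1 - y) ℤ.* g (del G zero) y   ≡⟨ g-isolated G G-sym zero isolated y ⟨
  g G y                              ∎
  where
  open ≡-Reasoning
  isolated : ∀ w → G zero w ≡ false
  isolated w = ¬-not λ e → no-edge (zero , w , e)
  IH = Recursion-unique {f} {g} Rf Rg _ (del-symmetric G-sym zero) y

lemma6 : (∀ {n} (G : Matrix n) → Symmetric G → ∀ y → p₁ G y ≡ nullityPoly G y)
         × Recursion p₁
         × (∀ (f : ∀ {n} → Matrix n → ℤ → ℤ) → Recursion f →
              ∀ {n} (G : Matrix n) → Symmetric G → ∀ y → f G y ≡ p₁ G y)
lemma6 = p₁≡nullityPoly , Recursion-p₁ , λ f Rf → Recursion-unique {f} {p₁} Rf Recursion-p₁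
  where
  Recursion-p₁ : Recursion p₁
  Recursion-p₁ = Recursion-transport {nullityPoly} {p₁} (λ G G-sym y → sym (p₁≡nullityPoly G G-sym y))
                                     Recursion-nullityPoly
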